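{- For every integer $N\ge1$, \[\mu\left(2,\{1\}^{N-1}\right)=\frac{2^{N+1}-1}{2^{2N}}\,\zeta(N+1).\]
   Context: For positive integers $i_k,\dots,i_1$ with $i_k\ge2$, the multiple mixed value is $\mu(i_k,i_{k-1},\dots,i_1)=\sum \frac{1}{n_k^{i_k}n_{k-1}^{i_{k-1}}\cdots n_1^{i_1}}$, the sum over positive integers $n_k>n_{k-1}>\cdots>n_1$ with $n_j\equiv j \pmod 2$ for each $j$. $\mu(2,\{1\}^{N-1})$ denotes $\mu(2,1,\dots,1)$ with $N-1$ entries equal to $1$ (so $k=N$). $\zeta$ is the Riemann zeta function. -}

module Defs where

open import Data.Nat as ℕ using (ℕ; zero; suc; _^_; _%_)
open import Data.Nat.Properties using (m^n≢0)
open import Data.Bool using (Bool; true; false; if_then_else_)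
open import Data.Integer using (+_)
open import Data.Rational using (ℚ; _/_; _+_; _*_; 0ℚ; 1ℚ)

inv-pow : ℕ → ℕ → ℚ
inv-pow zero s = 0ℚ               -- never used (m ≥ 1 always)
inv-pow (suc n) s = (+ 1) / (suc n ^ s)
  where instance _ = m^n≢0 (suc n) s

sameParity : ℕ → ℕ → Bool
sameParity m j = (m % 2) ℕ.≡ᵇ (j % 2)

sumTo : ℕ → (ℕ → ℚ) → ℚ
sumTo zero f = 0ℚ
sumTo (suc B) f = sumTo B f + f (suc B)

-- tail k B = Σ_{B > n_k > … > n_1 ≥ 1, n_j ≡ j (mod 2)} 1/(n_k ⋯ n_1)
-- (the depth-k tail of all-ones exponents, with the parity conditions)
tail1 : ℕ → ℕ → ℚ
tail1 zero B = 1ℚ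
tail1 (suc k) zero = 0ℚ
tail1 (suc k) (suc B) =
  sumTo B (λ n → if sameParity n (suc k) then inv-pow n 1 * tail1 k n else 0ℚ)

-- Partial sum of μ(2,{1}^{N-1}) (depth N ≥ 1) truncated at n_N ≤ M:
-- Σ_{M ≥ n_N > … > n_1 ≥ 1, n_j ≡ j (mod 2)} 1/(n_N^2 n_{N-1} ⋯ n_1)
muPartial : ℕ → ℕ → ℚ
muPartial zero M = 0ℚ
muPartial (suc k) M =
  sumTo M (λ n → if sameParity n (suc k) then inv-pow n 2 * tail1 k n else 0ℚ)

zetaPartial : ℕ → ℕ → ℚ
zetaPartial s M = sumTo M (λ n → inv-pow n s)

{-# OPTIONS --safe #-}
module Submission where

-- Write B(n+1, c) = ∫₀¹ xⁿ (1-x)^(c-1) dx. For suitable weights w_j (w_0 = 1) the connected sums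
-- Φ_j(n) = Σ_{c ≤ K} w_j(c) B(n+1, c) satisfy Φ_0(n) ≈ 1/n, and Pascal's rule for B, an Euler
-- transformation and Abel summation give Σ_{a < n ≤ M, n ≢ a (mod 2)} Φ_j(n)/n = Φ_{j+1}(a) up to
-- errors 1/M and 1/(K+1). Peeling off the N levels of μ(2,{1}^(N-1)) one at a time, its partial
-- sum up to M lies within (log M)^N (1/M + 1/K) of Φ_N(0). A closed binomial form of the weights
-- gives Φ_N(0) = 2^(-N) Σ_{i odd} 2 i^(-N-1) P(at least i heads in K fair tosses); once K is
-- exponentially larger than i these probabilities are close to 1, so Φ_N(0) is close to
-- 2^(1-N) Σ_{i odd} i^(-N-1) = (2^(N+1) - 1) / 2^(2N) · ζ(N+1).

open import Defs

module Proof where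
  open import Data.Bool using (Bool; true; false; not; if_then_else_)
  open import Data.Empty using (⊥-elim)
  open import Data.Maybe.Base using (Maybe)
  open import Data.Nat as ℕ using (ℕ; zero; suc; pred; s≤s; z≤n; _^_; _!)
  open import Data.Nat.Combinatorics using (_C_; nC1≡n; nCk+nC[k+1]≡[n+1]C[k+1])
  open import Data.Nat.Combinatorics.Specification using (k>n⇒nCk≡0)
  import Data.Nat.Properties as ℕP
  open import Data.Nat.Tactic.RingSolver using (solve-∀)
  import Data.Integer as ℤ
  import Data.Integer.Properties as ℤP
  open import Data.Product using (∃; _×_; _,_; proj₁; proj₂)
  open import Data.Rational as ℚ using (ℚ; mkℚ; _/_; 0ℚ; 1ℚ; ½; _+_; _*_; _-_; -_; _≤_; _<_; ∣_∣; toℚᵘ)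
  import Data.Rational.Properties as ℚP
  import Data.Rational.Unnormalised as ℚᵘ
  import Data.Rational.Unnormalised.Properties as ℚᵘP
  open import Data.Sum using (_⊎_; inj₁; inj₂; [_,_]′)
  open import Function.Base using (it)
  open import Level using (0ℓ)
  open import Relation.Binary.PropositionalEquality
  open import Relation.Nullary using (yes; no; contradiction)
  open import Relation.Nullary.Decidable using (dec⇒maybe)
  open import Tactic.RingSolver using () renaming (solve-∀ to solve-ring)
  open import Tactic.RingSolver.Core.AlmostCommutativeRing using (AlmostCommutativeRing; fromCommutativeRing)

  ℚ-ring : AlmostCommutativeRing 0ℓ 0ℓ
  ℚ-ring = fromCommutativeRing ℚP.+-*-commutativeRing zero?
    where
    zero? : (x : ℚ) → Maybe (0ℚ ≡ x)
    zero? x = dec⇒maybe (0ℚ ℚP.≟ x)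

  _÷_ : (a d : ℕ) → .{{_ : ℕ.NonZero d}} → ℚ
  a ÷ d = ℤ.+ a / d

  infix 7 _÷_

  toℚᵘ-÷ : ∀ a d .{{_ : ℕ.NonZero d}} → toℚᵘ (a ÷ d) ℚᵘ.≃ (ℤ.+ a ℚᵘ./ d)
  toℚᵘ-÷ a (suc d) = ℚP.toℚᵘ-fromℚᵘ (ℚᵘ.mkℚᵘ (ℤ.+ a) d)

  ÷-cong : ∀ a b c d .{{_ : ℕ.NonZero b}} .{{_ : ℕ.NonZero d}} → a ℕ.* d ≡ c ℕ.* b → a ÷ b ≡ c ÷ d
  ÷-cong a b@(suc _) c d@(suc _) eq = ℚP.toℚᵘ-injective (ℚᵘP.≃-trans (toℚᵘ-÷ a b) (ℚᵘP.≃-trans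
    (ℚᵘ.*≡* (trans (sym (ℤP.pos-* a d)) (trans (cong ℤ.+_ eq) (ℤP.pos-* c b))))
    (ℚᵘP.≃-sym (toℚᵘ-÷ c d))))

  ÷-+ : ∀ a b c d .{{_ : ℕ.NonZero b}} .{{_ : ℕ.NonZero d}} →
        a ÷ b + c ÷ d ≡ ((a ℕ.* d ℕ.+ c ℕ.* b) ÷ (b ℕ.* d)) {{ℕP.m*n≢0 b d}}
  ÷-+ a b@(suc _) c d@(suc _) = ℚP.toℚᵘ-injective
    (ℚᵘP.≃-trans (ℚP.toℚᵘ-homo-+ (a ÷ b) (c ÷ d))
    (ℚᵘP.≃-trans (ℚᵘP.+-cong (toℚᵘ-÷ a b) (toℚᵘ-÷ c d))
    (ℚᵘP.≃-trans (ℚᵘ.*≡* (cong (ℤ._* ℤ.+ (b ℕ.* d)) numerator))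
    (ℚᵘP.≃-sym (toℚᵘ-÷ (a ℕ.* d ℕ.+ c ℕ.* b) (b ℕ.* d))))))
    where
    numerator : ℤ.+ a ℤ.* ℤ.+ d ℤ.+ ℤ.+ c ℤ.* ℤ.+ b ≡ ℤ.+ (a ℕ.* d ℕ.+ c ℕ.* b)
    numerator = trans (cong₂ ℤ._+_ (sym (ℤP.pos-* a d)) (sym (ℤP.pos-* c b))) (sym (ℤP.pos-+ (a ℕ.* d) (c ℕ.* b)))

  ÷-* : ∀ a b c d .{{_ : ℕ.NonZero b}} .{{_ : ℕ.NonZero d}} →
        (a ÷ b) * (c ÷ d) ≡ ((a ℕ.* c) ÷ (b ℕ.* d)) {{ℕP.m*n≢0 b d}}
  ÷-* a b@(suc _) c d@(suc _) = ℚP.toℚᵘ-injective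
    (ℚᵘP.≃-trans (ℚP.toℚᵘ-homo-* (a ÷ b) (c ÷ d))
    (ℚᵘP.≃-trans (ℚᵘP.*-cong (toℚᵘ-÷ a b) (toℚᵘ-÷ c d))
    (ℚᵘP.≃-trans (ℚᵘ.*≡* (cong (ℤ._* ℤ.+ (b ℕ.* d)) (sym (ℤP.pos-* a c))))
    (ℚᵘP.≃-sym (toℚᵘ-÷ (a ℕ.* c) (b ℕ.* d))))))

  ÷-mono-≤ : ∀ a b c d .{{_ : ℕ.NonZero b}} .{{_ : ℕ.NonZero d}} → a ℕ.* d ℕ.≤ c ℕ.* b → a ÷ b ≤ c ÷ d
  ÷-mono-≤ a b@(suc _) c d@(suc _) le = ℚP.toℚᵘ-cancel-≤
    (ℚᵘP.≤-respˡ-≃ (ℚᵘP.≃-sym (toℚᵘ-÷ a b)) (ℚᵘP.≤-respʳ-≃ (ℚᵘP.≃-sym (toℚᵘ-÷ c d))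
      (ℚᵘ.*≤* (subst₂ ℤ._≤_ (ℤP.pos-* a d) (ℤP.pos-* c b) (ℤ.+≤+ le)))))

  ÷-mono-< : ∀ a b c d .{{_ : ℕ.NonZero b}} .{{_ : ℕ.NonZero d}} → a ℕ.* d ℕ.< c ℕ.* b → a ÷ b < c ÷ d
  ÷-mono-< a b@(suc _) c d@(suc _) lt = ℚP.toℚᵘ-cancel-<
    (ℚᵘP.<-respˡ-≃ (ℚᵘP.≃-sym (toℚᵘ-÷ a b)) (ℚᵘP.<-respʳ-≃ (ℚᵘP.≃-sym (toℚᵘ-÷ c d))
      (ℚᵘ.*<* (subst₂ ℤ._<_ (ℤP.pos-* a d) (ℤP.pos-* c b) (ℤ.+<+ lt)))))

  ÷-congˡ : ∀ {a c} d .{{_ : ℕ.NonZero d}} → a ≡ c → a ÷ d ≡ c ÷ d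
  ÷-congˡ d refl = refl

  ÷-congʳ : ∀ a {b d} .{{_ : ℕ.NonZero d}} (b≡d : b ≡ d) → (a ÷ b) {{subst ℕ.NonZero (sym b≡d) it}} ≡ a ÷ d
  ÷-congʳ a refl = refl

  ÷-+-common : ∀ a b d .{{_ : ℕ.NonZero d}} → a ÷ d + b ÷ d ≡ (a ℕ.+ b) ÷ d
  ÷-+-common a b d@(suc _) = trans (÷-+ a d b d) (÷-cong (a ℕ.* d ℕ.+ b ℕ.* d) (d ℕ.* d) (a ℕ.+ b) d (lemma a b d))
    where
    lemma : ∀ a b d → (a ℕ.* d ℕ.+ b ℕ.* d) ℕ.* d ≡ (a ℕ.+ b) ℕ.* (d ℕ.* d)
    lemma = solve-∀

  ÷-cancelˡ : ∀ k a d .{{_ : ℕ.NonZero d}} → ((suc k ℕ.* a) ÷ (suc k ℕ.* d)) {{ℕP.m*n≢0 (suc k) d}} ≡ a ÷ d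
  ÷-cancelˡ k a d@(suc _) = ÷-cong (suc k ℕ.* a) (suc k ℕ.* d) a d (lemma (suc k) a d)
    where
    lemma : ∀ k a d → k ℕ.* a ℕ.* d ≡ a ℕ.* (k ℕ.* d)
    lemma = solve-∀

  0≤÷ : ∀ a d .{{_ : ℕ.NonZero d}} → 0ℚ ≤ a ÷ d
  0≤÷ a d = subst (_≤ a ÷ d) (÷-cong 0 d 0 1 refl) (÷-mono-≤ 0 d a d z≤n)

  toℚ : ℕ → ℚ
  toℚ n = n ÷ 1

  -- 1/n, with the junk value 1/0 = 0.
  recip : ℕ → ℚ
  recip zero = 0ℚ
  recip (suc n) = 1 ÷ suc n

  toℚ-+ : ∀ m n → toℚ (m ℕ.+ n) ≡ toℚ m + toℚ n
  toℚ-+ m n = sym (trans (÷-+ m 1 n 1) (÷-cong (m ℕ.* 1 ℕ.+ n ℕ.* 1) (1 ℕ.* 1) (m ℕ.+ n) 1 (lemma m n)))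
    where
    lemma : ∀ m n → (m ℕ.* 1 ℕ.+ n ℕ.* 1) ℕ.* 1 ≡ (m ℕ.+ n) ℕ.* 1
    lemma = solve-∀

  toℚ-* : ∀ m n → toℚ (m ℕ.* n) ≡ toℚ m * toℚ n
  toℚ-* m n = sym (÷-* m 1 n 1)

  toℚ-suc : ∀ n → toℚ (suc n) ≡ 1ℚ + toℚ n
  toℚ-suc n = toℚ-+ 1 n

  0≤toℚ : ∀ n → 0ℚ ≤ toℚ n
  0≤toℚ n = 0≤÷ n 1

  toℚ-mono-≤ : ∀ {m n} → m ℕ.≤ n → toℚ m ≤ toℚ n
  toℚ-mono-≤ {m} {n} le = ÷-mono-≤ m 1 n 1 (ℕP.*-monoˡ-≤ 1 le)

  recip-inverseˡ : ∀ n → recip (suc n) * toℚ (suc n) ≡ 1ℚ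
  recip-inverseˡ n = trans (÷-* 1 (suc n) (suc n) 1) (÷-cong (1 ℕ.* suc n) (suc n ℕ.* 1) 1 1 (lemma n))
    where
    lemma : ∀ n → (1 ℕ.* suc n) ℕ.* 1 ≡ 1 ℕ.* (suc n ℕ.* 1)
    lemma = solve-∀

  recip-inverseʳ : ∀ n → toℚ (suc n) * recip (suc n) ≡ 1ℚ
  recip-inverseʳ n = trans (ℚP.*-comm (toℚ (suc n)) (recip (suc n))) (recip-inverseˡ n)

  recip-* : ∀ m n → recip (suc m) * recip (suc n) ≡ recip (suc m ℕ.* suc n)
  recip-* m n = ÷-* 1 (suc m) 1 (suc n)

  0≤recip : ∀ n → 0ℚ ≤ recip n
  0≤recip zero = ℚP.≤-refl
  0≤recip (suc n) = 0≤÷ 1 (suc n)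

  recip-antimono : ∀ {m n} → m ℕ.≤ n → recip (suc n) ≤ recip (suc m)
  recip-antimono le = ÷-mono-≤ 1 _ 1 _ (ℕP.*-monoʳ-≤ 1 (s≤s le))

  0≤1 : 0ℚ ≤ 1ℚ
  0≤1 = ÷-mono-≤ 0 1 1 1 z≤n

  recip≤1 : ∀ n → recip n ≤ 1ℚ
  recip≤1 zero = 0≤1
  recip≤1 (suc n) = recip-antimono {0} {n} z≤n

  *-monoˡ-≤-0≤ : ∀ {r p q} → 0ℚ ≤ r → p ≤ q → r * p ≤ r * q
  *-monoˡ-≤-0≤ {r} 0≤r = ℚP.*-monoˡ-≤-nonNeg r {{ℚ.nonNegative 0≤r}}

  *-monoʳ-≤-0≤ : ∀ {r p q} → 0ℚ ≤ r → p ≤ q → p * r ≤ q * r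
  *-monoʳ-≤-0≤ {r} 0≤r = ℚP.*-monoʳ-≤-nonNeg r {{ℚ.nonNegative 0≤r}}

  0≤-* : ∀ {p q} → 0ℚ ≤ p → 0ℚ ≤ q → 0ℚ ≤ p * q
  0≤-* {p} {q} 0≤p 0≤q = subst (_≤ p * q) (ℚP.*-zeroˡ q) (*-monoʳ-≤-0≤ 0≤q 0≤p)

  0≤-+ : ∀ {p q} → 0ℚ ≤ p → 0ℚ ≤ q → 0ℚ ≤ p + q
  0≤-+ = ℚP.+-mono-≤

  *-≤1 : ∀ {p q} → 0ℚ ≤ p → p ≤ 1ℚ → q ≤ 1ℚ → p * q ≤ 1ℚ
  *-≤1 {p} 0≤p p≤1 q≤1 = ℚP.≤-trans (*-monoˡ-≤-0≤ 0≤p q≤1) (subst (_≤ 1ℚ) (sym (ℚP.*-identityʳ p)) p≤1)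

  p≤p+q : ∀ {p q} → 0ℚ ≤ q → p ≤ p + q
  p≤p+q {p} {q} 0≤q = subst (_≤ p + q) (ℚP.+-identityʳ p) (ℚP.+-monoʳ-≤ p 0≤q)

  p-q≤p : ∀ {p q} → 0ℚ ≤ q → p - q ≤ p
  p-q≤p {p} {q} 0≤q = subst (p - q ≤_) (ℚP.+-identityʳ p) (ℚP.+-monoʳ-≤ p (ℚP.neg-antimono-≤ 0≤q))

  -‿monoʳ-≤ : ∀ {p q r} → q ≤ r → p - r ≤ p - q
  -‿monoʳ-≤ {p} q≤r = ℚP.+-monoʳ-≤ p (ℚP.neg-antimono-≤ q≤r)

  p≤q⇒0≤q-p : ∀ {p q} → p ≤ q → 0ℚ ≤ q - p
  p≤q⇒0≤q-p {p} {q} p≤q = subst (_≤ q - p) (ℚP.+-inverseʳ p) (ℚP.+-monoˡ-≤ (- p) p≤q)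

  p-q≤r⇒p≤q+r : ∀ {p q r} → p - q ≤ r → p ≤ q + r
  p-q≤r⇒p≤q+r {p} {q} {r} le = subst₂ _≤_ (lemma p q) (ℚP.+-comm r q) (ℚP.+-monoˡ-≤ q le)
    where
    lemma : ∀ p q → p - q + q ≡ p
    lemma = solve-ring ℚ-ring

  0≤p-q⇒q≤p : ∀ {p q} → 0ℚ ≤ p - q → q ≤ p
  0≤p-q⇒q≤p {p} {q} le = subst₂ _≤_ (ℚP.+-identityˡ q) (lemma p q) (ℚP.+-monoˡ-≤ q le)
    where
    lemma : ∀ p q → p - q + q ≡ p
    lemma = solve-ring ℚ-ring

  *-mono-bounds : ∀ s {L R U} → 0ℚ ≤ s → L ≤ R × R ≤ U → s * L ≤ s * R × s * R ≤ s * U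
  *-mono-bounds s 0≤s (L≤R , R≤U) = *-monoˡ-≤-0≤ 0≤s L≤R , *-monoˡ-≤-0≤ 0≤s R≤U

  recip-*-÷ : ∀ k a d .{{_ : ℕ.NonZero d}} → recip (suc k) * ((suc k ℕ.* a) ÷ d) ≡ a ÷ d
  recip-*-÷ k a d@(suc _) = trans (÷-* 1 (suc k) (suc k ℕ.* a) d) (÷-cong (1 ℕ.* (suc k ℕ.* a)) (suc k ℕ.* d) a d (lemma (suc k) a d))
    where
    lemma : ∀ k a d → 1 ℕ.* (k ℕ.* a) ℕ.* d ≡ a ℕ.* (k ℕ.* d)
    lemma = solve-∀

  toℚ-*-1÷ : ∀ a d .{{_ : ℕ.NonZero d}} → toℚ a * (1 ÷ d) ≡ a ÷ d
  toℚ-*-1÷ a d@(suc _) = trans (÷-* a 1 1 d) (÷-cong (a ℕ.* 1) (1 ℕ.* d) a d (lemma a d))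
    where
    lemma : ∀ a d → a ℕ.* 1 ℕ.* d ≡ a ℕ.* (1 ℕ.* d)
    lemma = solve-∀

  sumTo-cong : ∀ M {f g} → (∀ n → suc n ℕ.≤ M → f (suc n) ≡ g (suc n)) → sumTo M f ≡ sumTo M g
  sumTo-cong zero eq = refl
  sumTo-cong (suc M) eq = cong₂ _+_ (sumTo-cong M (λ n le → eq n (ℕP.m≤n⇒m≤1+n le))) (eq M ℕP.≤-refl)

  sumTo-mono-≤ : ∀ M {f g} → (∀ n → suc n ℕ.≤ M → f (suc n) ≤ g (suc n)) → sumTo M f ≤ sumTo M g
  sumTo-mono-≤ zero le = ℚP.≤-refl
  sumTo-mono-≤ (suc M) le = ℚP.+-mono-≤ (sumTo-mono-≤ M (λ n le′ → le n (ℕP.m≤n⇒m≤1+n le′))) (le M ℕP.≤-refl)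

  sumTo-zero : ∀ M → sumTo M (λ _ → 0ℚ) ≡ 0ℚ
  sumTo-zero zero = refl
  sumTo-zero (suc M) = cong (_+ 0ℚ) (sumTo-zero M)

  sumTo-nonneg : ∀ M {f} → (∀ n → suc n ℕ.≤ M → 0ℚ ≤ f (suc n)) → 0ℚ ≤ sumTo M f
  sumTo-nonneg M {f} h = subst (_≤ sumTo M f) (sumTo-zero M) (sumTo-mono-≤ M h)

  sumTo-+ : ∀ M f g → sumTo M (λ n → f n + g n) ≡ sumTo M f + sumTo M g
  sumTo-+ zero f g = refl
  sumTo-+ (suc M) f g = trans (cong (_+ (f (suc M) + g (suc M))) (sumTo-+ M f g)) (lemma (sumTo M f) (sumTo M g) (f (suc M)) (g (suc M)))
    where
    lemma : ∀ a b c d → a + b + (c + d) ≡ a + c + (b + d)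
    lemma = solve-ring ℚ-ring

  sumTo-minus : ∀ M f g → sumTo M (λ n → f n - g n) ≡ sumTo M f - sumTo M g
  sumTo-minus zero f g = refl
  sumTo-minus (suc M) f g = trans (cong (_+ (f (suc M) - g (suc M))) (sumTo-minus M f g)) (lemma (sumTo M f) (sumTo M g) (f (suc M)) (g (suc M)))
    where
    lemma : ∀ a b c d → a - b + (c - d) ≡ a + c - (b + d)
    lemma = solve-ring ℚ-ring

  sumTo-*ˡ : ∀ M c f → sumTo M (λ n → c * f n) ≡ c * sumTo M f
  sumTo-*ˡ zero c f = sym (ℚP.*-zeroʳ c)
  sumTo-*ˡ (suc M) c f = trans (cong (_+ c * f (suc M)) (sumTo-*ˡ M c f)) (sym (ℚP.*-distribˡ-+ c (sumTo M f) (f (suc M))))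

  sumTo-*ʳ : ∀ M c f → sumTo M (λ n → f n * c) ≡ sumTo M f * c
  sumTo-*ʳ M c f = trans (sumTo-cong M (λ n _ → ℚP.*-comm (f (suc n)) c)) (trans (sumTo-*ˡ M c f) (ℚP.*-comm c (sumTo M f)))

  sumTo-const : ∀ M c → sumTo M (λ _ → c) ≡ toℚ M * c
  sumTo-const zero c = sym (ℚP.*-zeroˡ c)
  sumTo-const (suc M) c = begin
    sumTo M (λ _ → c) + c   ≡⟨ cong (_+ c) (sumTo-const M c) ⟩
    toℚ M * c + c           ≡⟨ lemma (toℚ M) c ⟩
    (1ℚ + toℚ M) * c        ≡⟨ cong (_* c) (toℚ-suc M) ⟨
    toℚ (suc M) * c         ∎
    where
    open ≡-Reasoning
    lemma : ∀ m c → m * c + c ≡ (1ℚ + m) * c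
    lemma = solve-ring ℚ-ring

  sumTo-split : ∀ L d f → sumTo (L ℕ.+ d) f ≡ sumTo L f + sumTo d (λ i → f (L ℕ.+ i))
  sumTo-split L zero f = trans (cong (λ z → sumTo z f) (ℕP.+-identityʳ L)) (sym (ℚP.+-identityʳ (sumTo L f)))
  sumTo-split L (suc d) f = begin
    sumTo (L ℕ.+ suc d) f
      ≡⟨ cong (λ z → sumTo z f) (ℕP.+-suc L d) ⟩
    sumTo (L ℕ.+ d) f + f (suc (L ℕ.+ d))
      ≡⟨ cong (_+ f (suc (L ℕ.+ d))) (sumTo-split L d f) ⟩
    sumTo L f + sumTo d (λ i → f (L ℕ.+ i)) + f (suc (L ℕ.+ d))
      ≡⟨ ℚP.+-assoc (sumTo L f) _ _ ⟩
    sumTo L f + (sumTo d (λ i → f (L ℕ.+ i)) + f (suc (L ℕ.+ d)))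
      ≡⟨ cong (λ z → sumTo L f + (sumTo d (λ i → f (L ℕ.+ i)) + f z)) (ℕP.+-suc L d) ⟨
    sumTo L f + sumTo (suc d) (λ i → f (L ℕ.+ i)) ∎
    where open ≡-Reasoning

  sumTo-shift : ∀ b f → sumTo (suc b) f ≡ f 1 + sumTo b (λ i → f (suc i))
  sumTo-shift zero f = ℚP.+-comm 0ℚ (f 1)
  sumTo-shift (suc b) f = trans (cong (_+ f (suc (suc b))) (sumTo-shift b f)) (ℚP.+-assoc (f 1) _ _)

  sumTo-monoˡ-≤ : ∀ {f} → (∀ n → 0ℚ ≤ f (suc n)) → ∀ {M M′} → M ℕ.≤ M′ → sumTo M f ≤ sumTo M′ f
  sumTo-monoˡ-≤ {f} 0≤f {M} {M′} M≤M′ = begin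
    sumTo M f                                    ≤⟨ p≤p+q (sumTo-nonneg (M′ ℕ.∸ M) (λ i _ → subst (λ k → 0ℚ ≤ f k) (sym (ℕP.+-suc M i)) (0≤f (M ℕ.+ i)))) ⟩
    sumTo M f + sumTo (M′ ℕ.∸ M) (λ i → f (M ℕ.+ i)) ≡⟨ sumTo-split M (M′ ℕ.∸ M) f ⟨
    sumTo (M ℕ.+ (M′ ℕ.∸ M)) f                   ≡⟨ cong (λ z → sumTo z f) (ℕP.m+[n∸m]≡n M≤M′) ⟩
    sumTo M′ f                                   ∎
    where open ℚP.≤-Reasoning

  sumTo-vanishing : ∀ b c f → b ℕ.≤ c → (∀ i → b ℕ.< i → f i ≡ 0ℚ) → sumTo c f ≡ sumTo b f
  sumTo-vanishing b c f b≤c f≡0 = begin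
    sumTo c f                                     ≡⟨ cong (λ z → sumTo z f) (ℕP.m+[n∸m]≡n b≤c) ⟨
    sumTo (b ℕ.+ (c ℕ.∸ b)) f                     ≡⟨ sumTo-split b (c ℕ.∸ b) f ⟩
    sumTo b f + sumTo (c ℕ.∸ b) (λ i → f (b ℕ.+ i)) ≡⟨ cong (sumTo b f +_) tail≡0 ⟩
    sumTo b f + 0ℚ                                ≡⟨ ℚP.+-identityʳ (sumTo b f) ⟩
    sumTo b f                                     ∎
    where
    open ≡-Reasoning
    tail≡0 : sumTo (c ℕ.∸ b) (λ i → f (b ℕ.+ i)) ≡ 0ℚ
    tail≡0 = trans (sumTo-cong (c ℕ.∸ b) (λ i _ → f≡0 (b ℕ.+ suc i) (ℕP.m<m+n b (s≤s z≤n)))) (sumTo-zero (c ℕ.∸ b))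

  sumTo-swap : ∀ A B (g : ℕ → ℕ → ℚ) → sumTo A (λ x → sumTo B (g x)) ≡ sumTo B (λ y → sumTo A (λ x → g x y))
  sumTo-swap zero B g = sym (sumTo-zero B)
  sumTo-swap (suc A) B g = trans (cong (_+ sumTo B (g (suc A))) (sumTo-swap A B g))
    (sym (sumTo-+ B (λ y → sumTo A (λ x → g x y)) (g (suc A))))

  sumTo-telescope : ∀ M (Y : ℕ → ℚ) → sumTo M (λ n → Y (pred n) - Y n) ≡ Y 0 - Y M
  sumTo-telescope zero Y = sym (ℚP.+-inverseʳ (Y 0))
  sumTo-telescope (suc M) Y = trans (cong (_+ (Y M - Y (suc M))) (sumTo-telescope M Y)) (lemma (Y 0) (Y M) (Y (suc M)))
    where
    lemma : ∀ a b c → a - b + (b - c) ≡ a - c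
    lemma = solve-ring ℚ-ring

  sumTo-exchange-< : ∀ M f g → sumTo M (λ n → f n * sumTo (pred n) g) ≡ sumTo M (λ a → g a * (sumTo M f - sumTo a f))
  sumTo-exchange-< zero f g = refl
  sumTo-exchange-< (suc M) f g = begin
    sumTo M (λ n → f n * sumTo (pred n) g) + f (suc M) * sumTo M g
      ≡⟨ cong₂ _+_ (sumTo-exchange-< M f g) (ℚP.*-comm (f (suc M)) (sumTo M g)) ⟩
    sumTo M (λ a → g a * (F M - F a)) + sumTo M g * f (suc M)
      ≡⟨ cong (sumTo M (λ a → g a * (F M - F a)) +_) (sumTo-*ʳ M (f (suc M)) g) ⟨
    sumTo M (λ a → g a * (F M - F a)) + sumTo M (λ a → g a * f (suc M))
      ≡⟨ sumTo-+ M _ _ ⟨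
    sumTo M (λ a → g a * (F M - F a) + g a * f (suc M))
      ≡⟨ sumTo-cong M (λ a _ → distrib (g (suc a)) (F M) (F (suc a)) (f (suc M))) ⟩
    sumTo M (λ a → g a * (F (suc M) - F a))
      ≡⟨ ℚP.+-identityʳ _ ⟨
    sumTo M (λ a → g a * (F (suc M) - F a)) + 0ℚ
      ≡⟨ cong (sumTo M (λ a → g a * (F (suc M) - F a)) +_) (vanish (g (suc M)) (F (suc M))) ⟩
    sumTo (suc M) (λ a → g a * (F (suc M) - F a)) ∎
    where
    open ≡-Reasoning
    F = λ m → sumTo m f
    distrib : ∀ y S T x → y * (S - T) + y * x ≡ y * (S + x - T)
    distrib = solve-ring ℚ-ring
    vanish : ∀ y S → 0ℚ ≡ y * (S - S)
    vanish = solve-ring ℚ-ring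

  sumTo-exchange-≤ : ∀ K u s → sumTo K (λ b → u b * (sumTo K s - sumTo (pred b) s)) ≡ sumTo K (λ c → s c * sumTo c u)
  sumTo-exchange-≤ zero u s = refl
  sumTo-exchange-≤ (suc K) u s = begin
    sumTo K (λ b → u b * (S (suc K) - S (pred b))) + u (suc K) * (S (suc K) - S K)
      ≡⟨ cong (_+ u (suc K) * (S (suc K) - S K)) (sumTo-cong K (λ b _ → distrib (u (suc b)) (S K) (s (suc K)) (S b))) ⟩
    sumTo K (λ b → u b * (S K - S (pred b)) + u b * s (suc K)) + u (suc K) * (S (suc K) - S K)
      ≡⟨ cong (_+ u (suc K) * (S (suc K) - S K)) (sumTo-+ K _ _) ⟩
    sumTo K (λ b → u b * (S K - S (pred b))) + sumTo K (λ b → u b * s (suc K)) + u (suc K) * (S (suc K) - S K)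
      ≡⟨ cong₂ (λ a b → a + b + u (suc K) * (S (suc K) - S K)) (sumTo-exchange-≤ K u s) (sumTo-*ʳ K (s (suc K)) u) ⟩
    sumTo K (λ c → s c * sumTo c u) + sumTo K u * s (suc K) + u (suc K) * (S K + s (suc K) - S K)
      ≡⟨ collect (sumTo K (λ c → s c * sumTo c u)) (sumTo K u) (s (suc K)) (u (suc K)) (S K) ⟩
    sumTo K (λ c → s c * sumTo c u) + s (suc K) * (sumTo K u + u (suc K)) ∎
    where
    open ≡-Reasoning
    S = λ m → sumTo m s
    distrib : ∀ y S x T → y * (S + x - T) ≡ y * (S - T) + y * x
    distrib = solve-ring ℚ-ring
    collect : ∀ A U x y S → A + U * x + y * (S + x - S) ≡ A + x * (U + y)
    collect = solve-ring ℚ-ring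

  -- Powers of ½ and the Beta connector

  ½^_ : ℕ → ℚ
  ½^ zero = 1ℚ
  ½^ suc c = ½ * ½^ c

  ½*2≡1 : ½ * toℚ 2 ≡ 1ℚ
  ½*2≡1 = recip-inverseˡ 1

  toℚ-2^-suc : ∀ c → toℚ (2 ^ suc c) ≡ toℚ 2 * toℚ (2 ^ c)
  toℚ-2^-suc c = toℚ-* 2 (2 ^ c)

  ½+½≡1 : ½ + ½ ≡ 1ℚ
  ½+½≡1 = refl

  ½^*2^≡1 : ∀ c → ½^ c * toℚ (2 ^ c) ≡ 1ℚ
  ½^*2^≡1 zero = refl
  ½^*2^≡1 (suc c) = begin
    ½ * ½^ c * toℚ (2 ^ suc c)          ≡⟨ cong (½ * ½^ c *_) (toℚ-2^-suc c) ⟩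
    ½ * ½^ c * (toℚ 2 * toℚ (2 ^ c))    ≡⟨ lemma ½ (½^ c) (toℚ 2) (toℚ (2 ^ c)) ⟩
    ½ * toℚ 2 * (½^ c * toℚ (2 ^ c))    ≡⟨ cong₂ _*_ ½*2≡1 (½^*2^≡1 c) ⟩
    1ℚ                                  ∎
    where
    open ≡-Reasoning
    lemma : ∀ a b c d → a * b * (c * d) ≡ a * c * (b * d)
    lemma = solve-ring ℚ-ring

  ½^-+ : ∀ a b → ½^ (a ℕ.+ b) ≡ ½^ a * ½^ b
  ½^-+ zero b = sym (ℚP.*-identityˡ (½^ b))
  ½^-+ (suc a) b = trans (cong (½ *_) (½^-+ a b)) (sym (ℚP.*-assoc ½ (½^ a) (½^ b)))

  ½^≡1÷2^ : ∀ s → ½^ s ≡ (1 ÷ 2 ^ s) {{ℕP.m^n≢0 2 s}}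
  ½^≡1÷2^ zero = refl
  ½^≡1÷2^ (suc s) = trans (cong (½ *_) (½^≡1÷2^ s)) (÷-* 1 2 1 (2 ^ s) {{_}} {{ℕP.m^n≢0 2 s}})

  0≤½^ : ∀ c → 0ℚ ≤ ½^ c
  0≤½^ zero = 0≤1
  0≤½^ (suc c) = 0≤-* (0≤recip 2) (0≤½^ c)

  ½^≤1 : ∀ c → ½^ c ≤ 1ℚ
  ½^≤1 zero = ℚP.≤-refl
  ½^≤1 (suc c) = *-≤1 (0≤recip 2) (recip≤1 2) (½^≤1 c)

  ½^-suc-≤ : ∀ c → ½^ suc c ≤ ½^ c
  ½^-suc-≤ c = subst (½^ suc c ≤_) (ℚP.*-identityˡ (½^ c)) (*-monoʳ-≤-0≤ (0≤½^ c) (recip≤1 2))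

  sumTo-2^ : ∀ c → sumTo c (λ b → toℚ (2 ^ pred b)) + 1ℚ ≡ toℚ (2 ^ c)
  sumTo-2^ zero = ℚP.+-identityˡ 1ℚ
  sumTo-2^ (suc c) = begin
    sumTo c (λ b → toℚ (2 ^ pred b)) + toℚ (2 ^ c) + 1ℚ   ≡⟨ swap (sumTo c (λ b → toℚ (2 ^ pred b))) (toℚ (2 ^ c)) 1ℚ ⟩
    sumTo c (λ b → toℚ (2 ^ pred b)) + 1ℚ + toℚ (2 ^ c)   ≡⟨ cong (_+ toℚ (2 ^ c)) (sumTo-2^ c) ⟩
    toℚ (2 ^ c) + toℚ (2 ^ c)                           ≡⟨ double (toℚ (2 ^ c)) ⟩
    (1ℚ + 1ℚ) * toℚ (2 ^ c)                             ≡⟨ cong (_* toℚ (2 ^ c)) (toℚ-+ 1 1) ⟨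
    toℚ 2 * toℚ (2 ^ c)                                 ≡⟨ toℚ-2^-suc c ⟨
    toℚ (2 ^ suc c)                                     ∎
    where
    open ≡-Reasoning
    swap : ∀ a b c → a + b + c ≡ a + c + b
    swap = solve-ring ℚ-ring
    double : ∀ x → x + x ≡ (1ℚ + 1ℚ) * x
    double = solve-ring ℚ-ring

  -- β n c = B(n+1, c) = ∫₀¹ xⁿ (1-x)^(c-1) dx = n! (c-1)! / (n+c)!, and β n 0 = 0.
  β : ℕ → ℕ → ℚ
  β n zero = 0ℚ
  β n (suc c) = ((n ! ℕ.* c !) ÷ suc (n ℕ.+ c) !) {{suc (n ℕ.+ c) ℕP.!≢0}}

  0≤β : ∀ n c → 0ℚ ≤ β n c
  0≤β n zero = ℚP.≤-refl
  0≤β n (suc c) = 0≤÷ (n ! ℕ.* c !) (suc (n ℕ.+ c) !) {{suc (n ℕ.+ c) ℕP.!≢0}}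

  β-pascal : ∀ n c → β n (suc c) ≡ β (suc n) (suc c) + β n (suc (suc c))
  β-pascal n c = sym (begin
    β (suc n) (suc c) + β n (suc (suc c))
      ≡⟨ cong (β (suc n) (suc c) +_) (÷-congʳ (n ! ℕ.* suc c !) (cong (λ x → suc x !) (ℕP.+-suc n c))) ⟩
    (suc n ! ℕ.* c !) ÷ G + (n ! ℕ.* suc c !) ÷ G
      ≡⟨ ÷-+-common (suc n ! ℕ.* c !) (n ! ℕ.* suc c !) G ⟩
    (suc n ! ℕ.* c ! ℕ.+ n ! ℕ.* suc c !) ÷ G
      ≡⟨ ÷-congˡ G (numerator n c (n !) (c !)) ⟩
    (suc (suc (n ℕ.+ c)) ℕ.* (n ! ℕ.* c !)) ÷ G
      ≡⟨ ÷-cancelˡ (suc (n ℕ.+ c)) (n ! ℕ.* c !) (suc (n ℕ.+ c) !) ⟩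
    β n (suc c) ∎)
    where
    open ≡-Reasoning
    G = suc (suc (n ℕ.+ c)) !
    instance
      G≢0 : ℕ.NonZero G
      G≢0 = suc (suc (n ℕ.+ c)) ℕP.!≢0
      F≢0 : ℕ.NonZero (suc (n ℕ.+ c) !)
      F≢0 = suc (n ℕ.+ c) ℕP.!≢0
    numerator : ∀ n c x y → suc n ℕ.* x ℕ.* y ℕ.+ x ℕ.* (suc c ℕ.* y) ≡ suc (suc (n ℕ.+ c)) ℕ.* (x ℕ.* y)
    numerator = solve-∀

  β-0 : ∀ c → β 0 (suc c) ≡ recip (suc c)
  β-0 c = ÷-cong (1 ℕ.* c !) (suc c !) 1 (suc c) {{suc c ℕP.!≢0}} (lemma c (c !))
    where
    lemma : ∀ c x → 1 ℕ.* x ℕ.* suc c ≡ 1 ℕ.* (suc c ℕ.* x)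
    lemma = solve-∀

  β-1 : ∀ m → β m 1 ≡ recip (suc m)
  β-1 m = begin
    β m 1                          ≡⟨ ÷-congʳ (m ! ℕ.* 1) (cong (λ x → suc x !) (ℕP.+-identityʳ m)) ⟩
    (m ! ℕ.* 1) ÷ (suc m !)        ≡⟨ ÷-cong (m ! ℕ.* 1) (suc m !) 1 (suc m) (lemma m (m !)) ⟩
    recip (suc m)                  ∎
    where
    open ≡-Reasoning
    instance
      _ = suc m ℕP.!≢0
    lemma : ∀ m x → x ℕ.* 1 ℕ.* suc m ≡ 1 ℕ.* (suc m ℕ.* x)
    lemma = solve-∀

  β-shift : ∀ n b → recip (suc n) * β (suc n) (suc b) ≡ recip (suc b) * β n (suc (suc b))
  β-shift n b = begin
    recip (suc n) * β (suc n) (suc b)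
      ≡⟨ cong (recip (suc n) *_) (÷-congˡ G (ℕP.*-assoc (suc n) (n !) (b !))) ⟩
    recip (suc n) * ((suc n ℕ.* (n ! ℕ.* b !)) ÷ G)
      ≡⟨ recip-*-÷ n (n ! ℕ.* b !) G ⟩
    (n ! ℕ.* b !) ÷ G
      ≡⟨ recip-*-÷ b (n ! ℕ.* b !) G ⟨
    recip (suc b) * ((suc b ℕ.* (n ! ℕ.* b !)) ÷ G)
      ≡⟨ cong (recip (suc b) *_) (÷-congˡ G (swap (suc b) (n !) (b !))) ⟩
    recip (suc b) * ((n ! ℕ.* suc b !) ÷ G)
      ≡⟨ cong (recip (suc b) *_) (÷-congʳ (n ! ℕ.* suc b !) (cong (λ x → suc x !) (ℕP.+-suc n b))) ⟨
    recip (suc b) * β n (suc (suc b)) ∎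
    where
    open ≡-Reasoning
    G = suc (suc (n ℕ.+ b)) !
    instance
      _ = suc (suc (n ℕ.+ b)) ℕP.!≢0
    swap : ∀ x y z → x ℕ.* (y ℕ.* z) ≡ y ℕ.* (x ℕ.* z)
    swap = solve-∀

  β-antimono : ∀ n c → β (suc n) c ≤ β n c
  β-antimono n zero = ℚP.≤-refl
  β-antimono n (suc c) = subst (β (suc n) (suc c) ≤_) (sym (β-pascal n c)) (p≤p+q (0≤β n (suc (suc c))))

  β≤recip : ∀ n c → β n (suc c) ≤ recip (suc c)
  β≤recip zero c = ℚP.≤-reflexive (β-0 c)
  β≤recip (suc n) c = ℚP.≤-trans (β-antimono n (suc c)) (β≤recip n c)

  sumTo-β : ∀ m K → sumTo K (β (suc m)) + β m (suc K) ≡ recip (suc m)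
  sumTo-β m zero = trans (ℚP.+-identityˡ (β m 1)) (β-1 m)
  sumTo-β m (suc K) = begin
    sumTo K (β (suc m)) + β (suc m) (suc K) + β m (suc (suc K))
      ≡⟨ ℚP.+-assoc (sumTo K (β (suc m))) _ _ ⟩
    sumTo K (β (suc m)) + (β (suc m) (suc K) + β m (suc (suc K)))
      ≡⟨ cong (sumTo K (β (suc m)) +_) (β-pascal m K) ⟨
    sumTo K (β (suc m)) + β m (suc K)
      ≡⟨ sumTo-β m K ⟩
    recip (suc m) ∎
    where open ≡-Reasoning

  sameParity-suc : ∀ m j → sameParity (suc m) (suc j) ≡ sameParity m j
  sameParity-suc (suc (suc m)) j = sameParity-suc m j
  sameParity-suc m (suc (suc j)) = sameParity-suc m j
  sameParity-suc zero zero = refl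
  sameParity-suc zero (suc zero) = refl
  sameParity-suc (suc zero) zero = refl
  sameParity-suc (suc zero) (suc zero) = refl

  sameParity-suc-false : ∀ a k → sameParity a k ≡ true → sameParity (suc a) k ≡ false
  sameParity-suc-false (suc (suc a)) k = sameParity-suc-false a k
  sameParity-suc-false a (suc (suc k)) = sameParity-suc-false a k
  sameParity-suc-false zero zero _ = refl
  sameParity-suc-false (suc zero) (suc zero) _ = refl

  odd : ℕ → Bool
  odd n = sameParity n 1

  odd-suc : ∀ n → odd (suc n) ≡ not (odd n)
  odd-suc zero = refl
  odd-suc (suc zero) = refl
  odd-suc (suc (suc n)) = odd-suc n

  odd-double : ∀ L → odd (L ℕ.+ L) ≡ false
  odd-double zero = refl
  odd-double (suc L) = trans (cong (λ x → odd (suc x)) (ℕP.+-suc L L)) (odd-double L)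

  χodd : ℕ → ℚ
  χodd i = if odd i then 1ℚ else 0ℚ

  χodd-suc : ∀ i → χodd (suc i) ≡ 1ℚ - χodd i
  χodd-suc i rewrite odd-suc i with odd i
  ... | true = refl
  ... | false = refl

  χodd-double : ∀ L → χodd (L ℕ.+ L) ≡ 0ℚ
  χodd-double L rewrite odd-double L = refl

  χodd-double+1 : ∀ L → χodd (suc (L ℕ.+ L)) ≡ 1ℚ
  χodd-double+1 L rewrite odd-suc (L ℕ.+ L) | odd-double L = refl

  0≤χodd≤1 : ∀ i → 0ℚ ≤ χodd i × χodd i ≤ 1ℚ
  0≤χodd≤1 i with odd i
  ... | true = 0≤1 , ℚP.≤-refl
  ... | false = ℚP.≤-refl , 0≤1

  -- Weights and stride-two sums of β

  weight : ℕ → ℕ → ℚ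
  weight zero c = 1ℚ
  weight (suc j) c = ½^ c * sumTo c (λ b → weight j b * recip b * toℚ (2 ^ pred b))

  0≤weight≤1 : ∀ j c → 0ℚ ≤ weight j c × weight j c ≤ 1ℚ
  0≤weight≤1 zero c = 0≤1 , ℚP.≤-refl
  0≤weight≤1 (suc j) c =
    0≤-* (0≤½^ c) (sumTo-nonneg c (λ b _ → 0≤-* (0≤-* (proj₁ (0≤weight≤1 j (suc b))) (0≤recip (suc b))) (0≤toℚ (2 ^ b)))) ,
    ℚP.≤-trans (*-monoˡ-≤-0≤ (0≤½^ c) sum≤2^c) (ℚP.≤-reflexive (½^*2^≡1 c))
    where
    term≤2^ : ∀ b → weight j b * recip b * toℚ (2 ^ pred b) ≤ toℚ (2 ^ pred b)
    term≤2^ b = subst (weight j b * recip b * toℚ (2 ^ pred b) ≤_) (ℚP.*-identityˡ (toℚ (2 ^ pred b))) (*-monoʳ-≤-0≤ (0≤toℚ (2 ^ pred b))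
      (*-≤1 (proj₁ (0≤weight≤1 j b)) (proj₂ (0≤weight≤1 j b)) (recip≤1 b)))
    sum≤2^c : sumTo c (λ b → weight j b * recip b * toℚ (2 ^ pred b)) ≤ toℚ (2 ^ c)
    sum≤2^c = ℚP.≤-trans (sumTo-mono-≤ c (λ b _ → term≤2^ (suc b)))
      (subst (sumTo c (λ b → toℚ (2 ^ pred b)) ≤_) (sumTo-2^ c) (p≤p+q 0≤1))

  0≤weight : ∀ j c → 0ℚ ≤ weight j c
  0≤weight j c = proj₁ (0≤weight≤1 j c)

  weight≤1 : ∀ j c → weight j c ≤ 1ℚ
  weight≤1 j c = proj₂ (0≤weight≤1 j c)

  β₂ : ℕ → ℕ → ℕ → ℚ
  β₂ a zero c = 0ℚ
  β₂ a (suc P) c = β a (suc c) + β₂ (suc (suc a)) P c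

  end₂ : ℕ → ℕ → ℕ
  end₂ a zero = a
  end₂ a (suc P) = end₂ (suc (suc a)) P

  0≤β₂ : ∀ a P c → 0ℚ ≤ β₂ a P c
  0≤β₂ a zero c = ℚP.≤-refl
  0≤β₂ a (suc P) c = 0≤-+ (0≤β a (suc c)) (0≤β₂ (suc (suc a)) P c)

  β₂≤β : ∀ a P c → β₂ a P (suc c) ≤ β a (suc c)
  β₂≤β a zero c = 0≤β a (suc c)
  β₂≤β a (suc P) c = begin
    β a (suc (suc c)) + β₂ (suc (suc a)) P (suc c)  ≤⟨ ℚP.+-monoʳ-≤ (β a (suc (suc c))) (β₂≤β (suc (suc a)) P c) ⟩
    β a (suc (suc c)) + β (suc (suc a)) (suc c)     ≤⟨ ℚP.+-monoʳ-≤ (β a (suc (suc c))) (β-antimono (suc a) (suc c)) ⟩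
    β a (suc (suc c)) + β (suc a) (suc c)           ≡⟨ ℚP.+-comm (β a (suc (suc c))) (β (suc a) (suc c)) ⟩
    β (suc a) (suc c) + β a (suc (suc c))           ≡⟨ β-pascal a c ⟨
    β a (suc c)                                     ∎
    where open ℚP.≤-Reasoning

  βgap : ℕ → ℕ → ℕ → ℚ
  βgap a P c = β a c - β (end₂ a P) c

  -- An Euler transformation: 2 β₂(c) = βgap(c+1) + β₂(c+1), by Pascal's rule twice.
  β₂-double : ∀ a P c → β₂ a P (suc c) + β₂ a P (suc c) ≡ βgap a P (suc c) + β₂ a P (suc (suc c))
  β₂-double a zero c = lemma (β a (suc c))
    where
    lemma : ∀ w → 0ℚ + 0ℚ ≡ w - w + 0ℚ
    lemma = solve-ring ℚ-ring
  β₂-double a (suc P) c = begin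
    (β a (suc (suc c)) + S) + (β a (suc (suc c)) + S)
      ≡⟨ cong (λ z → (z + S) + (z + S)) (β-pascal a (suc c)) ⟩
    (y + z + S) + (y + z + S)
      ≡⟨ regroup₁ y z S ⟩
    (y + z) + (y + z) + (S + S)
      ≡⟨ cong ((y + z) + (y + z) +_) (β₂-double (suc (suc a)) P c) ⟩
    (y + z) + (y + z) + (x - E + R)
      ≡⟨ regroup₂ x y z E R ⟩
    ((x + y) + (y + z) - E) + (z + R)
      ≡⟨ cong (λ t → (t - E) + (z + R)) (trans (β-pascal a c) (cong₂ _+_ (β-pascal (suc a) c) (β-pascal a (suc c)))) ⟨
    (β a (suc c) - E) + (z + R) ∎
    where
    open ≡-Reasoning
    S = β₂ (suc (suc a)) P (suc c)
    R = β₂ (suc (suc a)) P (suc (suc c))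
    E = β (end₂ (suc (suc a)) P) (suc c)
    x = β (suc (suc a)) (suc c)
    y = β (suc a) (suc (suc c))
    z = β a (suc (suc (suc c)))
    regroup₁ : ∀ y z S → (y + z + S) + (y + z + S) ≡ (y + z) + (y + z) + (S + S)
    regroup₁ = solve-ring ℚ-ring
    regroup₂ : ∀ x y z E R → (y + z) + (y + z) + (x - E + R) ≡ ((x + y) + (y + z) - E) + (z + R)
    regroup₂ = solve-ring ℚ-ring

  β₂-telescope : ∀ a P m → sumTo m (λ c → βgap a P c * ½^ c) ≡ β₂ a P 1 * 1ℚ - β₂ a P (suc m) * ½^ m
  β₂-telescope a P m = trans (sumTo-cong m (λ c _ → sym (step c))) (sumTo-telescope m Y)
    where
    Y : ℕ → ℚ
    Y c = β₂ a P (suc c) * ½^ c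
    step : ∀ c → Y c - Y (suc c) ≡ βgap a P (suc c) * ½^ suc c
    step c = begin
      A * h - A′ * (½ * h)            ≡⟨ cong (_- A′ * (½ * h)) (ℚP.*-identityʳ (A * h)) ⟨
      A * h * 1ℚ - A′ * (½ * h)       ≡⟨ cong (λ u → A * h * u - A′ * (½ * h)) ½+½≡1 ⟨
      A * h * (½ + ½) - A′ * (½ * h)  ≡⟨ regroup A A′ h ½ ⟩
      (A + A - A′) * (½ * h)          ≡⟨ cong (_* (½ * h)) (cancel A (βgap a P (suc c)) A′ (β₂-double a P c)) ⟩
      βgap a P (suc c) * (½ * h)      ∎
      where
      open ≡-Reasoning
      A = β₂ a P (suc c)
      A′ = β₂ a P (suc (suc c))
      h = ½^ c
      regroup : ∀ A A′ h t → A * h * (t + t) - A′ * (t * h) ≡ (A + A - A′) * (t * h)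
      regroup = solve-ring ℚ-ring
      cancel : ∀ A D A′ → A + A ≡ D + A′ → A + A - A′ ≡ D
      cancel A D A′ eq = trans (cong (_- A′) eq) (lemma D A′)
        where
        lemma : ∀ D A′ → D + A′ - A′ ≡ D
        lemma = solve-ring ℚ-ring

  β₂-as-gap-sum : ∀ a P b m → β₂ a P (suc b) * ½^ b ≡
    sumTo m (λ c → βgap a P c * ½^ c) - sumTo b (λ c → βgap a P c * ½^ c) + β₂ a P (suc m) * ½^ m
  β₂-as-gap-sum a P b m = trans (lemma (β₂ a P 1 * 1ℚ) (β₂ a P (suc b) * ½^ b) (β₂ a P (suc m) * ½^ m))
    (cong₂ (λ s t → s - t + β₂ a P (suc m) * ½^ m) (sym (β₂-telescope a P m)) (sym (β₂-telescope a P b)))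
    where
    lemma : ∀ y₀ y y′ → y ≡ (y₀ - y′) - (y₀ - y) + y′
    lemma = solve-ring ℚ-ring

  inv-pow-suc : ∀ m s → inv-pow (suc m) (suc s) ≡ recip (suc m) * inv-pow (suc m) s
  inv-pow-suc m s = sym (÷-* 1 (suc m) 1 (suc m ^ s) {{_}} {{ℕP.m^n≢0 (suc m) s}})

  inv-pow-1 : ∀ m → inv-pow (suc m) 1 ≡ recip (suc m)
  inv-pow-1 m = trans (inv-pow-suc m 0) (ℚP.*-identityʳ (recip (suc m)))

  inv-pow-2 : ∀ m → inv-pow (suc m) 2 ≡ recip (suc m) * recip (suc m)
  inv-pow-2 m = trans (inv-pow-suc m 1) (cong (recip (suc m) *_) (inv-pow-1 m))

  0≤inv-pow : ∀ m s → 0ℚ ≤ inv-pow m s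
  0≤inv-pow zero s = ℚP.≤-refl
  0≤inv-pow (suc m) s = 0≤÷ 1 (suc m ^ s) {{ℕP.m^n≢0 (suc m) s}}

  tailTerm : ℕ → ℕ → ℚ
  tailTerm k n = if sameParity n (suc k) then inv-pow n 1 * tail1 k n else 0ℚ

  0≤tail1 : ∀ k B → 0ℚ ≤ tail1 k B
  0≤tailTerm : ∀ k n → 0ℚ ≤ tailTerm k n
  0≤tail1 zero B = 0≤1
  0≤tail1 (suc k) zero = ℚP.≤-refl
  0≤tail1 (suc k) (suc B) = sumTo-nonneg B (λ n _ → 0≤tailTerm k (suc n))
  0≤tailTerm k n with sameParity n (suc k)
  ... | true = 0≤-* (0≤inv-pow n 1) (0≤tail1 k n)
  ... | false = ℚP.≤-refl

  tailsUpTo : ℕ → ℕ → ℚ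
  tailsUpTo zero M = 1ℚ
  tailsUpTo (suc k) M = tailsUpTo k M + tail1 (suc k) (suc M)

  harmonic-double : ∀ a → sumTo (a ℕ.+ a) recip ≤ sumTo a recip + 1ℚ
  harmonic-double a = begin
    sumTo (a ℕ.+ a) recip                              ≡⟨ sumTo-split a a recip ⟩
    sumTo a recip + sumTo a (λ i → recip (a ℕ.+ i))    ≤⟨ ℚP.+-monoʳ-≤ (sumTo a recip) (sumTo-mono-≤ a (λ i _ → term i)) ⟩
    sumTo a recip + sumTo a (λ _ → recip (suc a))      ≡⟨ cong (sumTo a recip +_) (sumTo-const a (recip (suc a))) ⟩
    sumTo a recip + toℚ a * recip (suc a)              ≤⟨ ℚP.+-monoʳ-≤ (sumTo a recip) a*recip[a+1]≤1 ⟩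
    sumTo a recip + 1ℚ                                 ∎
    where
    open ℚP.≤-Reasoning
    term : ∀ i → recip (a ℕ.+ suc i) ≤ recip (suc a)
    term i = subst (λ z → recip z ≤ recip (suc a)) (sym (ℕP.+-suc a i)) (recip-antimono (ℕP.m≤m+n a i))
    a*recip[a+1]≤1 : toℚ a * recip (suc a) ≤ 1ℚ
    a*recip[a+1]≤1 = ℚP.≤-trans (*-monoʳ-≤-0≤ (0≤recip (suc a)) (toℚ-mono-≤ (ℕP.n≤1+n a))) (ℚP.≤-reflexive (recip-inverseʳ a))

  harmonic-2^ : ∀ ℓ → sumTo (2 ^ ℓ) recip ≤ toℚ (suc ℓ)
  harmonic-2^ zero = ℚP.≤-refl
  harmonic-2^ (suc ℓ) = begin
    sumTo (2 ^ suc ℓ) recip               ≡⟨ cong (λ z → sumTo z recip) (cong (2 ^ ℓ ℕ.+_) (ℕP.+-identityʳ (2 ^ ℓ))) ⟩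
    sumTo (2 ^ ℓ ℕ.+ 2 ^ ℓ) recip         ≤⟨ harmonic-double (2 ^ ℓ) ⟩
    sumTo (2 ^ ℓ) recip + 1ℚ              ≤⟨ ℚP.+-monoˡ-≤ 1ℚ (harmonic-2^ ℓ) ⟩
    toℚ (suc ℓ) + 1ℚ                      ≡⟨ ℚP.+-comm (toℚ (suc ℓ)) 1ℚ ⟩
    1ℚ + toℚ (suc ℓ)                      ≡⟨ toℚ-suc (suc ℓ) ⟨
    toℚ (suc (suc ℓ))                     ∎
    where open ℚP.≤-Reasoning

  tail1-mono : ∀ i {B B′} → B ℕ.≤ B′ → tail1 i B ≤ tail1 i B′
  tail1-mono zero _ = ℚP.≤-refl
  tail1-mono (suc i) {zero} {B′} _ = 0≤tail1 (suc i) B′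
  tail1-mono (suc i) {suc B} {suc B′} (s≤s B≤B′) = sumTo-monoˡ-≤ (λ n → 0≤tailTerm i (suc n)) B≤B′

  tailTerm≤ : ∀ i n B → n ℕ.≤ B → tailTerm i (suc n) ≤ recip (suc n) * tail1 i (suc B)
  tailTerm≤ i n B n≤B with sameParity (suc n) (suc i)
  ... | true = subst (_≤ recip (suc n) * tail1 i (suc B)) (cong (_* tail1 i (suc n)) (sym (inv-pow-1 n)))
                 (*-monoˡ-≤-0≤ (0≤recip (suc n)) (tail1-mono i (s≤s n≤B)))
  ... | false = 0≤-* (0≤recip (suc n)) (0≤tail1 i (suc B))

  tail1≤ : ∀ i M q → sumTo M recip ≤ toℚ q → tail1 i (suc M) ≤ toℚ (q ^ i)
  tail1≤ zero M q _ = ℚP.≤-refl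
  tail1≤ (suc i) M q H≤q = begin
    sumTo M (tailTerm i)                         ≤⟨ sumTo-mono-≤ M (λ n n<M → tailTerm≤ i n M (ℕP.<⇒≤ n<M)) ⟩
    sumTo M (λ n → recip n * tail1 i (suc M))    ≡⟨ sumTo-*ʳ M (tail1 i (suc M)) recip ⟩
    sumTo M recip * tail1 i (suc M)              ≤⟨ ℚP.≤-trans (*-monoʳ-≤-0≤ (0≤tail1 i (suc M)) H≤q) (*-monoˡ-≤-0≤ (0≤toℚ q) (tail1≤ i M q H≤q)) ⟩
    toℚ q * toℚ (q ^ i)                          ≡⟨ toℚ-* q (q ^ i) ⟨
    toℚ (q ^ suc i)                              ∎
    where open ℚP.≤-Reasoning

  tailsUpTo≤ : ∀ k M q → sumTo M recip ≤ toℚ (suc q) → tailsUpTo k M ≤ toℚ (suc k ℕ.* suc q ^ k)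
  tailsUpTo≤ zero M q _ = ℚP.≤-refl
  tailsUpTo≤ (suc k) M q H≤q = begin
    tailsUpTo k M + tail1 (suc k) (suc M)                ≤⟨ ℚP.+-mono-≤ (tailsUpTo≤ k M q H≤q) (tail1≤ (suc k) M (suc q) H≤q) ⟩
    toℚ (suc k ℕ.* Q ^ k) + toℚ (Q ^ suc k)              ≡⟨ toℚ-+ (suc k ℕ.* Q ^ k) (Q ^ suc k) ⟨
    toℚ (suc k ℕ.* Q ^ k ℕ.+ Q ^ suc k)                  ≤⟨ toℚ-mono-≤ (ℕP.+-monoˡ-≤ (Q ^ suc k) (ℕP.*-monoʳ-≤ (suc k) (ℕP.^-monoʳ-≤ Q (ℕP.n≤1+n k)))) ⟩
    toℚ (suc k ℕ.* Q ^ suc k ℕ.+ Q ^ suc k)              ≡⟨ cong toℚ (ℕP.+-comm (suc k ℕ.* Q ^ suc k) (Q ^ suc k)) ⟩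
    toℚ (suc (suc k) ℕ.* Q ^ suc k)                      ∎
    where
    open ℚP.≤-Reasoning
    Q = suc q

  muPartial-mono : ∀ n {M M′} → M ℕ.≤ M′ → muPartial (suc n) M ≤ muPartial (suc n) M′
  muPartial-mono n = sumTo-monoˡ-≤ term≥0
    where
    term≥0 : ∀ m → 0ℚ ≤ (if sameParity (suc m) (suc n) then inv-pow (suc m) 2 * tail1 n (suc m) else 0ℚ)
    term≥0 m with sameParity (suc m) (suc n)
    ... | true = 0≤-* (0≤inv-pow (suc m) 2) (0≤tail1 n (suc m))
    ... | false = ℚP.≤-refl

  -- Binomial coefficients and the closed form of the weights

  C-pascal : ∀ n k → suc n C suc k ≡ n C k ℕ.+ n C suc k
  C-pascal n k = sym (nCk+nC[k+1]≡[n+1]C[k+1] n k)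

  C-absorb : ∀ n k → suc k ℕ.* (suc n C suc k) ≡ suc n ℕ.* (n C k)
  C-absorb zero zero = refl
  C-absorb zero (suc k) = ℕP.*-zeroʳ (suc (suc k))
  C-absorb (suc n) zero = trans (cong (λ z → 1 ℕ.* z) (trans (C-pascal (suc n) 0) (cong suc (nC1≡n (suc n))))) (lemma n)
    where
    lemma : ∀ n → 1 ℕ.* (1 ℕ.+ suc n) ≡ suc (suc n) ℕ.* 1
    lemma = solve-∀
  C-absorb (suc n) (suc k) = begin
    suc (suc k) ℕ.* (suc (suc n) C suc (suc k))
      ≡⟨ cong (suc (suc k) ℕ.*_) (C-pascal (suc n) (suc k)) ⟩
    suc (suc k) ℕ.* (suc n C suc k ℕ.+ suc n C suc (suc k))
      ≡⟨ lemma₁ k (suc n C suc k) (suc n C suc (suc k)) ⟩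
    suc k ℕ.* (suc n C suc k) ℕ.+ suc n C suc k ℕ.+ suc (suc k) ℕ.* (suc n C suc (suc k))
      ≡⟨ cong₂ (λ x y → x ℕ.+ suc n C suc k ℕ.+ y) (C-absorb n k) (C-absorb n (suc k)) ⟩
    suc n ℕ.* (n C k) ℕ.+ suc n C suc k ℕ.+ suc n ℕ.* (n C suc k)
      ≡⟨ cong (λ x → suc n ℕ.* (n C k) ℕ.+ x ℕ.+ suc n ℕ.* (n C suc k)) (C-pascal n k) ⟩
    suc n ℕ.* (n C k) ℕ.+ (n C k ℕ.+ n C suc k) ℕ.+ suc n ℕ.* (n C suc k)
      ≡⟨ lemma₂ n (n C k) (n C suc k) ⟩
    suc (suc n) ℕ.* (n C k ℕ.+ n C suc k)
      ≡⟨ cong (suc (suc n) ℕ.*_) (C-pascal n k) ⟨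
    suc (suc n) ℕ.* (suc n C suc k) ∎
    where
    open ≡-Reasoning
    lemma₁ : ∀ k x y → suc (suc k) ℕ.* (x ℕ.+ y) ≡ suc k ℕ.* x ℕ.+ x ℕ.+ suc (suc k) ℕ.* y
    lemma₁ = solve-∀
    lemma₂ : ∀ n x y → suc n ℕ.* x ℕ.+ (x ℕ.+ y) ℕ.+ suc n ℕ.* y ≡ suc (suc n) ℕ.* (x ℕ.+ y)
    lemma₂ = solve-∀

  C≤^ : ∀ n t → n C t ℕ.≤ n ^ t
  C≤^ n zero = ℕP.≤-refl
  C≤^ zero (suc t) = z≤n
  C≤^ (suc n) (suc t) = begin
    suc n C suc t              ≡⟨ C-pascal n t ⟩
    n C t ℕ.+ n C suc t        ≤⟨ ℕP.+-mono-≤ (C≤^ n t) (C≤^ n (suc t)) ⟩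
    n ^ t ℕ.+ n ℕ.* n ^ t      ≤⟨ ℕP.*-monoʳ-≤ (suc n) (ℕP.^-monoˡ-≤ t (ℕP.n≤1+n n)) ⟩
    suc n ℕ.* suc n ^ t        ∎
    where open ℕP.≤-Reasoning

  C-hockey : ∀ c i → sumTo c (λ b → toℚ (pred b C i)) ≡ toℚ (c C suc i)
  C-hockey zero i = refl
  C-hockey (suc c) i = begin
    sumTo c (λ b → toℚ (pred b C i)) + toℚ (c C i)   ≡⟨ cong (_+ toℚ (c C i)) (C-hockey c i) ⟩
    toℚ (c C suc i) + toℚ (c C i)                    ≡⟨ toℚ-+ (c C suc i) (c C i) ⟨
    toℚ (c C suc i ℕ.+ c C i)                        ≡⟨ cong toℚ (trans (ℕP.+-comm (c C suc i) (c C i)) (sym (C-pascal c i))) ⟩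
    toℚ (suc c C suc i)                              ∎
    where open ≡-Reasoning

  sumTo-C-suc : ∀ b (f : ℕ → ℚ) → sumTo (suc b) (λ i → f i * toℚ (suc b C i)) ≡ f 1 + sumTo b (λ i → (f i + f (suc i)) * toℚ (b C i))
  sumTo-C-suc b f = begin
    sumTo (suc b) (λ i → f i * toℚ (suc b C i))
      ≡⟨ sumTo-cong (suc b) {λ i → f i * toℚ (suc b C i)} {λ i → f i * toℚ (b C pred i) + f i * toℚ (b C i)}
                    (λ i _ → trans (cong (λ n → f (suc i) * toℚ n) (C-pascal b i))
                                            (trans (cong (f (suc i) *_) (toℚ-+ (b C i) (b C suc i))) (ℚP.*-distribˡ-+ (f (suc i)) (toℚ (b C i)) (toℚ (b C suc i))))) ⟩
    sumTo (suc b) (λ i → f i * toℚ (b C pred i) + f i * toℚ (b C i))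
      ≡⟨ sumTo-+ (suc b) (λ i → f i * toℚ (b C pred i)) (λ i → f i * toℚ (b C i)) ⟩
    sumTo (suc b) (λ i → f i * toℚ (b C pred i)) + sumTo (suc b) (λ i → f i * toℚ (b C i))
      ≡⟨ cong₂ _+_ (sumTo-shift b (λ i → f i * toℚ (b C pred i))) top-vanishes ⟩
    f 1 * 1ℚ + sumTo b (λ i → f (suc i) * toℚ (b C i)) + sumTo b (λ i → f i * toℚ (b C i))
      ≡⟨ regroup (f 1) (sumTo b (λ i → f (suc i) * toℚ (b C i))) (sumTo b (λ i → f i * toℚ (b C i))) ⟩
    f 1 + (sumTo b (λ i → f i * toℚ (b C i)) + sumTo b (λ i → f (suc i) * toℚ (b C i)))
      ≡⟨ cong (f 1 +_) (sumTo-+ b (λ i → f i * toℚ (b C i)) (λ i → f (suc i) * toℚ (b C i))) ⟨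
    f 1 + sumTo b (λ i → f i * toℚ (b C i) + f (suc i) * toℚ (b C i))
      ≡⟨ cong (f 1 +_) (sumTo-cong b (λ i _ → sym (ℚP.*-distribʳ-+ (toℚ (b C suc i)) (f (suc i)) (f (suc (suc i)))))) ⟩
    f 1 + sumTo b (λ i → (f i + f (suc i)) * toℚ (b C i)) ∎
    where
    open ≡-Reasoning
    top-vanishes : sumTo (suc b) (λ i → f i * toℚ (b C i)) ≡ sumTo b (λ i → f i * toℚ (b C i))
    top-vanishes = sumTo-vanishing b (suc b) (λ i → f i * toℚ (b C i)) (ℕP.n≤1+n b)
      (λ i b<i → trans (cong (λ n → f i * toℚ n) (k>n⇒nCk≡0 b<i)) (ℚP.*-zeroʳ (f i)))
    regroup : ∀ x S T → x * 1ℚ + S + T ≡ x + (T + S)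
    regroup = solve-ring ℚ-ring

  sumTo-C : ∀ b → 1ℚ + sumTo b (λ i → toℚ (b C i)) ≡ toℚ (2 ^ b)
  sumTo-C zero = ℚP.+-identityʳ 1ℚ
  sumTo-C (suc b) = begin
    1ℚ + sumTo (suc b) (λ i → toℚ (suc b C i))
      ≡⟨ cong (1ℚ +_) (trans (sumTo-cong (suc b) {λ i → toℚ (suc b C i)} (λ i _ → sym (ℚP.*-identityˡ _))) (sumTo-C-suc b (λ _ → 1ℚ))) ⟩
    1ℚ + (1ℚ + sumTo b (λ i → (1ℚ + 1ℚ) * toℚ (b C i)))
      ≡⟨ cong (λ x → 1ℚ + (1ℚ + x)) (sumTo-*ˡ b (1ℚ + 1ℚ) (λ i → toℚ (b C i))) ⟩
    1ℚ + (1ℚ + (1ℚ + 1ℚ) * sumTo b (λ i → toℚ (b C i)))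
      ≡⟨ regroup (sumTo b (λ i → toℚ (b C i))) ⟩
    (1ℚ + 1ℚ) * (1ℚ + sumTo b (λ i → toℚ (b C i)))
      ≡⟨ cong₂ _*_ (sym (toℚ-+ 1 1)) (sumTo-C b) ⟩
    toℚ 2 * toℚ (2 ^ b)
      ≡⟨ toℚ-2^-suc b ⟨
    toℚ (2 ^ suc b) ∎
    where
    open ≡-Reasoning
    regroup : ∀ S → 1ℚ + (1ℚ + (1ℚ + 1ℚ) * S) ≡ (1ℚ + 1ℚ) * (1ℚ + S)
    regroup = solve-ring ℚ-ring

  sumTo-odd-C : ∀ b → sumTo (suc b) (λ i → χodd i * toℚ (suc b C i)) ≡ toℚ (2 ^ b)
  sumTo-odd-C b = begin
    sumTo (suc b) (λ i → χodd i * toℚ (suc b C i))                ≡⟨ sumTo-C-suc b χodd ⟩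
    1ℚ + sumTo b (λ i → (χodd i + χodd (suc i)) * toℚ (b C i))    ≡⟨ cong (1ℚ +_) (sumTo-cong b (λ i _ → pair i)) ⟩
    1ℚ + sumTo b (λ i → toℚ (b C i))                              ≡⟨ sumTo-C b ⟩
    toℚ (2 ^ b)                                                   ∎
    where
    open ≡-Reasoning
    complement : ∀ x y → x + (1ℚ - x) ≡ 1ℚ
    complement = solve-ring ℚ-ring
    pair : ∀ i → (χodd (suc i) + χodd (suc (suc i))) * toℚ (b C suc i) ≡ toℚ (b C suc i)
    pair i = trans (cong (λ x → (χodd (suc i) + x) * toℚ (b C suc i)) (χodd-suc (suc i)))
      (trans (cong (_* toℚ (b C suc i)) (complement (χodd (suc i)) 0ℚ)) (ℚP.*-identityˡ _))

  binomPrefix : ℕ → ℕ → ℚ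
  binomPrefix i K = sumTo i (λ t → toℚ (K C pred t))

  binomPrefix-0 : ∀ i → binomPrefix (suc i) 0 ≡ 1ℚ
  binomPrefix-0 zero = ℚP.+-identityˡ 1ℚ
  binomPrefix-0 (suc i) = trans (cong (_+ 0ℚ) (binomPrefix-0 i)) (ℚP.+-identityʳ 1ℚ)

  binomPrefix-suc : ∀ i K → binomPrefix (suc i) (suc K) + toℚ (K C i) ≡ binomPrefix (suc i) K + binomPrefix (suc i) K
  binomPrefix-suc zero K = refl
  binomPrefix-suc (suc i) K = begin
    L (suc K) + toℚ (suc K C suc i) + toℚ (K C suc i)
      ≡⟨ cong (λ z → L (suc K) + z + toℚ (K C suc i)) (trans (cong toℚ (C-pascal K i)) (toℚ-+ (K C i) (K C suc i))) ⟩
    L (suc K) + (toℚ (K C i) + toℚ (K C suc i)) + toℚ (K C suc i)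
      ≡⟨ regroup₁ (L (suc K)) (toℚ (K C i)) (toℚ (K C suc i)) ⟩
    L (suc K) + toℚ (K C i) + toℚ (K C suc i) + toℚ (K C suc i)
      ≡⟨ cong (λ z → z + toℚ (K C suc i) + toℚ (K C suc i)) (binomPrefix-suc i K) ⟩
    L K + L K + toℚ (K C suc i) + toℚ (K C suc i)
      ≡⟨ regroup₂ (L K) (toℚ (K C suc i)) ⟩
    (L K + toℚ (K C suc i)) + (L K + toℚ (K C suc i)) ∎
    where
    open ≡-Reasoning
    L = binomPrefix (suc i)
    regroup₁ : ∀ a b c → a + (b + c) + c ≡ a + b + c + c
    regroup₁ = solve-ring ℚ-ring
    regroup₂ : ∀ a c → a + a + c + c ≡ (a + c) + (a + c)
    regroup₂ = solve-ring ℚ-ring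

  0≤binomPrefix : ∀ i K → 0ℚ ≤ binomPrefix i K
  0≤binomPrefix i K = sumTo-nonneg i (λ t _ → 0≤toℚ (K C t))

  binomPrefix-mono : ∀ {i i′} K → i ℕ.≤ i′ → binomPrefix i K ≤ binomPrefix i′ K
  binomPrefix-mono K = sumTo-monoˡ-≤ (λ t → 0≤toℚ (K C t))

  binomPrefix≤ : ∀ i K → binomPrefix i (suc K) ≤ toℚ (i ℕ.* suc K ^ i)
  binomPrefix≤ zero K = ℚP.≤-refl
  binomPrefix≤ (suc i) K = begin
    binomPrefix i (suc K) + toℚ (suc K C i)         ≤⟨ ℚP.+-mono-≤ (binomPrefix≤ i K) (toℚ-mono-≤ (C≤^ (suc K) i)) ⟩
    toℚ (i ℕ.* suc K ^ i) + toℚ (suc K ^ i)          ≡⟨ toℚ-+ (i ℕ.* suc K ^ i) (suc K ^ i) ⟨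
    toℚ (i ℕ.* suc K ^ i ℕ.+ suc K ^ i)              ≤⟨ toℚ-mono-≤ (ℕP.≤-trans (ℕP.≤-reflexive (ℕP.+-comm _ (suc K ^ i)))
                                                        (ℕP.*-monoʳ-≤ (suc i) (ℕP.^-monoʳ-≤ (suc K) (ℕP.n≤1+n i)))) ⟩
    toℚ (suc i ℕ.* suc K ^ suc i)                    ∎
    where open ℚP.≤-Reasoning

  -- headsBy K i is the probability that the i-th head appears within K tosses of a fair coin,
  -- and ½^K · binomPrefix (i+1) K the probability of at most i heads in K tosses.
  headsBy : ℕ → ℕ → ℚ
  headsBy K i = sumTo K (λ c → ½^ c * toℚ (pred c C pred i))

  headsBy-complement : ∀ K i → headsBy K (suc i) + ½^ K * binomPrefix (suc i) K ≡ 1ℚ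
  headsBy-complement zero i = trans (ℚP.+-identityˡ _) (trans (ℚP.*-identityˡ _) (binomPrefix-0 i))
  headsBy-complement (suc K) i = begin
    headsBy K (suc i) + ½^ suc K * toℚ (K C i) + ½ * ½^ K * binomPrefix (suc i) (suc K)
      ≡⟨ regroup (headsBy K (suc i)) ½ (½^ K) (toℚ (K C i)) (binomPrefix (suc i) (suc K)) ⟩
    headsBy K (suc i) + ½ * ½^ K * (binomPrefix (suc i) (suc K) + toℚ (K C i))
      ≡⟨ cong (λ z → headsBy K (suc i) + ½ * ½^ K * z) (binomPrefix-suc i K) ⟩
    headsBy K (suc i) + ½ * ½^ K * (binomPrefix (suc i) K + binomPrefix (suc i) K)
      ≡⟨ cong (headsBy K (suc i) +_) (halve (½^ K) (binomPrefix (suc i) K)) ⟩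
    headsBy K (suc i) + ½^ K * binomPrefix (suc i) K
      ≡⟨ headsBy-complement K i ⟩
    1ℚ ∎
    where
    open ≡-Reasoning
    regroup : ∀ P h H b L → P + h * H * b + h * H * L ≡ P + h * H * (L + b)
    regroup = solve-ring ℚ-ring
    halve : ∀ H L → ½ * H * (L + L) ≡ H * L
    halve H L = trans (lemma ½ H L) (trans (cong (_* (H * L)) ½+½≡1) (ℚP.*-identityˡ (H * L)))
      where
      lemma : ∀ h H L → h * H * (L + L) ≡ (h + h) * (H * L)
      lemma = solve-ring ℚ-ring

  0≤headsBy : ∀ K i → 0ℚ ≤ headsBy K i
  0≤headsBy K i = sumTo-nonneg K (λ c _ → 0≤-* (0≤½^ (suc c)) (0≤toℚ (c C pred i)))

  headsBy≤1 : ∀ K i → headsBy K (suc i) ≤ 1ℚ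
  headsBy≤1 K i = subst (headsBy K (suc i) ≤_) (headsBy-complement K i) (p≤p+q (0≤-* (0≤½^ K) (0≤binomPrefix (suc i) K)))

  oddTerm : ℕ → ℕ → ℚ
  oddTerm j i = χodd i * toℚ 2 * inv-pow i j

  oddRow : ℕ → ℕ → ℚ
  oddRow j b = sumTo b (λ i → oddTerm j i * toℚ (b C i))

  recip-C-absorb : ∀ b i → recip (suc b) * toℚ (suc b C suc i) ≡ recip (suc i) * toℚ (b C i)
  recip-C-absorb b i = begin
    recip (suc b) * toℚ (suc b C suc i)          ≡⟨ ÷-* 1 (suc b) (suc b C suc i) 1 ⟩
    (1 ℕ.* (suc b C suc i)) ÷ (suc b ℕ.* 1)      ≡⟨ ÷-cong (1 ℕ.* (suc b C suc i)) (suc b ℕ.* 1) (1 ℕ.* (b C i)) (suc i ℕ.* 1) cross ⟩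
    (1 ℕ.* (b C i)) ÷ (suc i ℕ.* 1)              ≡⟨ ÷-* 1 (suc i) (b C i) 1 ⟨
    recip (suc i) * toℚ (b C i)                  ∎
    where
    open ≡-Reasoning
    unit : ∀ x y → 1 ℕ.* x ℕ.* (y ℕ.* 1) ≡ y ℕ.* x
    unit = solve-∀
    cross : 1 ℕ.* (suc b C suc i) ℕ.* (suc i ℕ.* 1) ≡ 1 ℕ.* (b C i) ℕ.* (suc b ℕ.* 1)
    cross = trans (unit (suc b C suc i) (suc i)) (trans (C-absorb b i) (sym (unit (b C i) (suc b))))

  recip-oddRow : ∀ j b → recip (suc b) * oddRow j (suc b) ≡ sumTo (suc b) (λ i → oddTerm (suc j) i * toℚ (b C pred i))
  recip-oddRow j b = trans (sym (sumTo-*ˡ (suc b) (recip (suc b)) (λ i → oddTerm j i * toℚ (suc b C i))))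
    (sumTo-cong (suc b) (λ i _ → begin
      recip (suc b) * (oddTerm j (suc i) * toℚ (suc b C suc i))      ≡⟨ swap (recip (suc b)) (oddTerm j (suc i)) _ ⟩
      oddTerm j (suc i) * (recip (suc b) * toℚ (suc b C suc i))      ≡⟨ cong (oddTerm j (suc i) *_) (recip-C-absorb b i) ⟩
      oddTerm j (suc i) * (recip (suc i) * toℚ (b C i))              ≡⟨ regroup (χodd (suc i)) (toℚ 2) (inv-pow (suc i) j) (recip (suc i)) (toℚ (b C i)) ⟩
      χodd (suc i) * toℚ 2 * (recip (suc i) * inv-pow (suc i) j) * toℚ (b C i)
                                                                      ≡⟨ cong (λ z → χodd (suc i) * toℚ 2 * z * toℚ (b C i)) (inv-pow-suc i j) ⟨
      oddTerm (suc j) (suc i) * toℚ (b C i)                           ∎))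
    where
    open ≡-Reasoning
    swap : ∀ a h c → a * (h * c) ≡ h * (a * c)
    swap = solve-ring ℚ-ring
    regroup : ∀ o t p r c → o * t * p * (r * c) ≡ o * t * (r * p) * c
    regroup = solve-ring ℚ-ring

  sumTo-C-extend : ∀ (t : ℕ → ℚ) b K → suc b ℕ.≤ K → sumTo K (λ i → t i * toℚ (b C pred i)) ≡ sumTo (suc b) (λ i → t i * toℚ (b C pred i))
  sumTo-C-extend t b K b<K = sumTo-vanishing (suc b) K (λ i → t i * toℚ (b C pred i)) b<K vanish
    where
    vanish : ∀ i → suc b ℕ.< i → t i * toℚ (b C pred i) ≡ 0ℚ
    vanish (suc i) (s≤s b<i) = trans (cong (λ n → t (suc i) * toℚ n) (k>n⇒nCk≡0 b<i)) (ℚP.*-zeroʳ (t (suc i)))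

  sumTo-shifted-oddRow : ∀ j c → sumTo c (λ b → sumTo b (λ i → oddTerm (suc j) i * toℚ (pred b C pred i))) ≡ oddRow (suc j) c
  sumTo-shifted-oddRow j c = begin
    sumTo c (λ b → sumTo b (λ i → t i * toℚ (pred b C pred i)))
      ≡⟨ sumTo-cong c (λ b b<c → sym (sumTo-C-extend t b c b<c)) ⟩
    sumTo c (λ b → sumTo c (λ i → t i * toℚ (pred b C pred i)))
      ≡⟨ sumTo-swap c c (λ b i → t i * toℚ (pred b C pred i)) ⟩
    sumTo c (λ i → sumTo c (λ b → t i * toℚ (pred b C pred i)))
      ≡⟨ sumTo-cong c (λ i _ → trans (sumTo-*ˡ c (t (suc i)) (λ b → toℚ (pred b C i))) (cong (t (suc i) *_) (C-hockey c i))) ⟩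
    oddRow (suc j) c ∎
    where
    open ≡-Reasoning
    t = oddTerm (suc j)

  weight-closed : ∀ j b → weight j (suc b) ≡ ½^ j * ½^ suc b * oddRow j (suc b)
  weight-closed zero b = sym (begin
    1ℚ * ½^ suc b * oddRow 0 (suc b)
      ≡⟨ cong (1ℚ * ½^ suc b *_) (trans (sumTo-cong (suc b) {λ i → oddTerm 0 i * toℚ (suc b C i)} (λ i _ → swap (χodd (suc i)) (toℚ (suc b C suc i))))
                                          (sumTo-*ˡ (suc b) (toℚ 2) (λ i → χodd i * toℚ (suc b C i)))) ⟩
    1ℚ * ½^ suc b * (toℚ 2 * sumTo (suc b) (λ i → χodd i * toℚ (suc b C i)))
      ≡⟨ cong (λ z → 1ℚ * ½^ suc b * (toℚ 2 * z)) (sumTo-odd-C b) ⟩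
    1ℚ * (½ * ½^ b) * (toℚ 2 * toℚ (2 ^ b))
      ≡⟨ regroup ½ (½^ b) (toℚ 2) (toℚ (2 ^ b)) ⟩
    (½ * toℚ 2) * (½^ b * toℚ (2 ^ b))
      ≡⟨ cong₂ _*_ ½*2≡1 (½^*2^≡1 b) ⟩
    1ℚ ∎)
    where
    open ≡-Reasoning
    swap : ∀ o x → o * toℚ 2 * 1ℚ * x ≡ toℚ 2 * (o * x)
    swap = solve-ring ℚ-ring
    regroup : ∀ h H t T → 1ℚ * (h * H) * (t * T) ≡ (h * t) * (H * T)
    regroup = solve-ring ℚ-ring
  weight-closed (suc j) b = begin
    ½^ suc b * sumTo (suc b) (λ b′ → weight j b′ * recip b′ * toℚ (2 ^ pred b′))
      ≡⟨ cong (½^ suc b *_) (sumTo-cong (suc b) (λ b′ _ → term b′)) ⟩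
    ½^ suc b * sumTo (suc b) (λ b′ → ½^ j * ½ * sumTo b′ (λ i → oddTerm (suc j) i * toℚ (pred b′ C pred i)))
      ≡⟨ cong (½^ suc b *_) (trans (sumTo-*ˡ (suc b) (½^ j * ½) _) (cong (½^ j * ½ *_) (sumTo-shifted-oddRow j (suc b)))) ⟩
    ½^ suc b * (½^ j * ½ * oddRow (suc j) (suc b))
      ≡⟨ regroup (½^ suc b) (½^ j) ½ (oddRow (suc j) (suc b)) ⟩
    ½ * ½^ j * ½^ suc b * oddRow (suc j) (suc b) ∎
    where
    open ≡-Reasoning
    regroup : ∀ H h f C → H * (h * f * C) ≡ f * h * H * C
    regroup = solve-ring ℚ-ring
    term : ∀ b′ → weight j (suc b′) * recip (suc b′) * toℚ (2 ^ b′)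
                ≡ ½^ j * ½ * sumTo (suc b′) (λ i → oddTerm (suc j) i * toℚ (b′ C pred i))
    term b′ = begin
      weight j (suc b′) * recip (suc b′) * toℚ (2 ^ b′)
        ≡⟨ cong (λ z → z * recip (suc b′) * toℚ (2 ^ b′)) (weight-closed j b′) ⟩
      ½^ j * (½ * ½^ b′) * oddRow j (suc b′) * recip (suc b′) * toℚ (2 ^ b′)
        ≡⟨ regroup′ (½^ j) ½ (½^ b′) (oddRow j (suc b′)) (recip (suc b′)) (toℚ (2 ^ b′)) ⟩
      ½^ j * ½ * (recip (suc b′) * oddRow j (suc b′)) * (½^ b′ * toℚ (2 ^ b′))
        ≡⟨ cong₂ (λ x y → ½^ j * ½ * x * y) (recip-oddRow j b′) (½^*2^≡1 b′) ⟩
      ½^ j * ½ * sumTo (suc b′) (λ i → oddTerm (suc j) i * toℚ (b′ C pred i)) * 1ℚ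
        ≡⟨ ℚP.*-identityʳ _ ⟩
      ½^ j * ½ * sumTo (suc b′) (λ i → oddTerm (suc j) i * toℚ (b′ C pred i)) ∎
      where
      regroup′ : ∀ h f H C r t → h * (f * H) * C * r * t ≡ h * f * (r * C) * (H * t)
      regroup′ = solve-ring ℚ-ring

  0≤oddTerm : ∀ j i → 0ℚ ≤ oddTerm j i
  0≤oddTerm j i = 0≤-* (0≤-* (proj₁ (0≤χodd≤1 i)) (0≤toℚ 2)) (0≤inv-pow i j)

  inv-pow≤1 : ∀ m s → inv-pow m s ≤ 1ℚ
  inv-pow≤1 zero s = 0≤1
  inv-pow≤1 (suc m) s = ÷-mono-≤ 1 (suc m ^ s) 1 1 {{ℕP.m^n≢0 (suc m) s}} (ℕP.*-monoʳ-≤ 1 (ℕP.m^n>0 (suc m) s))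

  oddTerm≤2 : ∀ j i → oddTerm j i ≤ toℚ 2
  oddTerm≤2 j i = begin
    χodd i * toℚ 2 * inv-pow i j     ≤⟨ *-monoˡ-≤-0≤ (0≤-* (proj₁ (0≤χodd≤1 i)) (0≤toℚ 2)) (inv-pow≤1 i j) ⟩
    χodd i * toℚ 2 * 1ℚ              ≡⟨ ℚP.*-identityʳ _ ⟩
    χodd i * toℚ 2                   ≤⟨ *-monoʳ-≤-0≤ (0≤toℚ 2) (proj₂ (0≤χodd≤1 i)) ⟩
    1ℚ * toℚ 2                       ≡⟨ ℚP.*-identityˡ (toℚ 2) ⟩
    toℚ 2                            ∎
    where open ℚP.≤-Reasoning

  oddTerm-*-headsBy≥ : ∀ j K M₀ i → suc i ℕ.≤ M₀ →
    oddTerm j (suc i) - toℚ 2 * (½^ K * binomPrefix M₀ K) ≤ oddTerm j (suc i) * headsBy K (suc i)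
  oddTerm-*-headsBy≥ j K M₀ i i<M₀ = begin
    t - toℚ 2 * (½^ K * binomPrefix M₀ K)
      ≤⟨ -‿monoʳ-≤ {t} (ℚP.≤-trans (*-monoʳ-≤-0≤ (0≤-* (0≤½^ K) (0≤binomPrefix (suc i) K)) (oddTerm≤2 j (suc i)))
                                  (*-monoˡ-≤-0≤ (0≤toℚ 2) (*-monoˡ-≤-0≤ (0≤½^ K) (binomPrefix-mono K i<M₀)))) ⟩
    t - t * (½^ K * binomPrefix (suc i) K)
      ≡⟨ distrib t (½^ K * binomPrefix (suc i) K) ⟩
    t * (1ℚ - ½^ K * binomPrefix (suc i) K)
      ≡⟨ cong (t *_) (complement (headsBy K (suc i)) _ (headsBy-complement K i)) ⟩
    t * headsBy K (suc i) ∎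
    where
    open ℚP.≤-Reasoning
    t = oddTerm j (suc i)
    distrib : ∀ h x → h - h * x ≡ h * (1ℚ - x)
    distrib = solve-ring ℚ-ring
    complement : ∀ P x → P + x ≡ 1ℚ → 1ℚ - x ≡ P
    complement P x eq = trans (cong (_- x) (sym eq)) (lemma P x)
      where
      lemma : ∀ P x → P + x - x ≡ P
      lemma = solve-ring ℚ-ring

  valueLimit : ℕ → ℕ → ℚ
  valueLimit N M = ½^ N * sumTo M (oddTerm (suc N))

  -- Connected sums truncated at K

  module Truncated (K : ℕ) where

    -- Φ j a approximates the contribution of the j highest levels of μ lying above a.
    Φ : ℕ → ℕ → ℚ
    Φ j n = sumTo K (λ c → weight j c * β n c)

    0≤Φ : ∀ j n → 0ℚ ≤ Φ j n
    0≤Φ j n = sumTo-nonneg K (λ c _ → 0≤-* (0≤weight j (suc c)) (0≤β n (suc c)))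

    Φ≤recip : ∀ j m n → suc m ℕ.≤ n → Φ j n ≤ recip (suc m)
    Φ≤recip j m (suc n) (s≤s m≤n) = begin
      Φ j (suc n)                                 ≤⟨ sumTo-mono-≤ K (λ c _ → weighted≤ (suc c)) ⟩
      sumTo K (β (suc n))                         ≤⟨ p≤p+q (0≤β n (suc K)) ⟩
      sumTo K (β (suc n)) + β n (suc K)           ≡⟨ sumTo-β n K ⟩
      recip (suc n)                               ≤⟨ recip-antimono m≤n ⟩
      recip (suc m)                               ∎
      where
      open ℚP.≤-Reasoning
      weighted≤ : ∀ c → weight j c * β (suc n) c ≤ β (suc n) c
      weighted≤ c = subst (weight j c * β (suc n) c ≤_) (ℚP.*-identityˡ (β (suc n) c))
        (*-monoʳ-≤-0≤ (0≤β (suc n) c) (weight≤1 j c))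

    recip-Φ-shift : ∀ j a → recip (suc a) * Φ j (suc a) ≡ sumTo K (λ b → weight j b * recip b * β a (suc b))
    recip-Φ-shift j a = trans (sym (sumTo-*ˡ K (recip (suc a)) (λ c → weight j c * β (suc a) c)))
      (sumTo-cong K (λ c _ → begin
        recip (suc a) * (weight j (suc c) * β (suc a) (suc c))   ≡⟨ swap (recip (suc a)) (weight j (suc c)) _ ⟩
        weight j (suc c) * (recip (suc a) * β (suc a) (suc c))   ≡⟨ cong (weight j (suc c) *_) (β-shift a c) ⟩
        weight j (suc c) * (recip (suc c) * β a (suc (suc c)))   ≡⟨ ℚP.*-assoc (weight j (suc c)) _ _ ⟨
        weight j (suc c) * recip (suc c) * β a (suc (suc c))     ∎))
      where
      open ≡-Reasoning
      swap : ∀ i x w → i * (x * w) ≡ x * (i * w)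
      swap = solve-ring ℚ-ring

    Ψ : ℕ → ℕ → ℕ → ℚ
    Ψ j a P = sumTo K (λ b → weight j b * recip b * β₂ a P b)

    Ψ-zero : ∀ j a → Ψ j a 0 ≡ 0ℚ
    Ψ-zero j a = trans (sumTo-cong K (λ b _ → ℚP.*-zeroʳ (weight j (suc b) * recip (suc b)))) (sumTo-zero K)

    Ψ-suc : ∀ j a P → Ψ j a (suc P) ≡ recip (suc a) * Φ j (suc a) + Ψ j (suc (suc a)) P
    Ψ-suc j a P = begin
      Ψ j a (suc P)
        ≡⟨ sumTo-cong K (λ b _ → ℚP.*-distribˡ-+ (weight j (suc b) * recip (suc b)) _ _) ⟩
      sumTo K (λ b → weight j b * recip b * β a (suc b) + weight j b * recip b * β₂ (suc (suc a)) P b)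
        ≡⟨ sumTo-+ K _ _ ⟩
      sumTo K (λ b → weight j b * recip b * β a (suc b)) + Ψ j (suc (suc a)) P
        ≡⟨ cong (_+ Ψ j (suc (suc a)) P) (recip-Φ-shift j a) ⟨
      recip (suc a) * Φ j (suc a) + Ψ j (suc (suc a)) P ∎
      where open ≡-Reasoning

    sumTo-βgap-weight : ∀ j a P → sumTo K (λ c → βgap a P c * weight j c) ≡ Φ j a - Φ j (end₂ a P)
    sumTo-βgap-weight j a P = trans (sumTo-cong K (λ c _ → distrib (β a (suc c)) (β (end₂ a P) (suc c)) (weight j (suc c))))
      (sumTo-minus K (λ c → weight j c * β a c) (λ c → weight j c * β (end₂ a P) c))
      where
      distrib : ∀ x y z → (x - y) * z ≡ z * x - z * y
      distrib = solve-ring ℚ-ring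

    -- Abel summation against the partial sums of βgap · ½^c, which produces the next weight.
    Ψ-abel : ∀ j a P → Ψ j a P ≡ Φ (suc j) a - Φ (suc j) (end₂ a P) + β₂ a P (suc K) * weight (suc j) K
    Ψ-abel j a P = begin
      Ψ j a P
        ≡⟨ sumTo-cong K (λ b _ → term b) ⟩
      sumTo K (λ b → u b * (S K - S (pred b)) + u b * Y)
        ≡⟨ sumTo-+ K _ _ ⟩
      sumTo K (λ b → u b * (S K - S (pred b))) + sumTo K (λ b → u b * Y)
        ≡⟨ cong₂ _+_ (sumTo-exchange-≤ K u g) (sumTo-*ʳ K Y u) ⟩
      sumTo K (λ c → g c * sumTo c u) + sumTo K u * Y
        ≡⟨ cong₂ _+_ (sumTo-cong K (λ c _ → ℚP.*-assoc (βgap a P (suc c)) (½^ suc c) (sumTo (suc c) u)))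
                     (regroup (sumTo K u) (β₂ a P (suc K)) (½^ K)) ⟩
      sumTo K (λ c → βgap a P c * weight (suc j) c) + β₂ a P (suc K) * weight (suc j) K
        ≡⟨ cong (_+ β₂ a P (suc K) * weight (suc j) K) (sumTo-βgap-weight (suc j) a P) ⟩
      Φ (suc j) a - Φ (suc j) (end₂ a P) + β₂ a P (suc K) * weight (suc j) K ∎
      where
      open ≡-Reasoning
      u : ℕ → ℚ
      u b = weight j b * recip b * toℚ (2 ^ pred b)
      g : ℕ → ℚ
      g c = βgap a P c * ½^ c
      S : ℕ → ℚ
      S m = sumTo m g
      Y = β₂ a P (suc K) * ½^ K
      regroup : ∀ U A h → U * (A * h) ≡ A * (h * U)
      regroup = solve-ring ℚ-ring
      rescale : ∀ x A h t → x * (A * (h * t)) ≡ x * t * (A * h)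
      rescale = solve-ring ℚ-ring
      term : ∀ b → weight j (suc b) * recip (suc b) * β₂ a P (suc b) ≡ u (suc b) * (S K - S b) + u (suc b) * Y
      term b = begin
        x * β₂ a P (suc b)                                 ≡⟨ cong (x *_) (ℚP.*-identityʳ (β₂ a P (suc b))) ⟨
        x * (β₂ a P (suc b) * 1ℚ)                          ≡⟨ cong (λ t → x * (β₂ a P (suc b) * t)) (½^*2^≡1 b) ⟨
        x * (β₂ a P (suc b) * (½^ b * toℚ (2 ^ b)))        ≡⟨ rescale x (β₂ a P (suc b)) (½^ b) (toℚ (2 ^ b)) ⟩
        u (suc b) * (β₂ a P (suc b) * ½^ b)                ≡⟨ cong (u (suc b) *_) (β₂-as-gap-sum a P b K) ⟩
        u (suc b) * (S K - S b + Y)                        ≡⟨ ℚP.*-distribˡ-+ (u (suc b)) (S K - S b) Y ⟩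
        u (suc b) * (S K - S b) + u (suc b) * Y            ∎
        where
        x = weight j (suc b) * recip (suc b)

    Φterm : ℕ → ℕ → ℕ → ℚ
    Φterm k j n = if sameParity n (suc k) then recip n * Φ j n else 0ℚ

    Φterm-same : ∀ k j n → sameParity n (suc k) ≡ true → Φterm k j n ≡ recip n * Φ j n
    Φterm-same k j n h rewrite h = refl

    Φterm-other : ∀ k j n → sameParity n (suc k) ≡ false → Φterm k j n ≡ 0ℚ
    Φterm-other k j n h rewrite h = refl

    Φsum : ℕ → ℕ → ℕ → ℕ → ℚ
    Φsum k j a M = sumTo M (Φterm k j) - sumTo a (Φterm k j)

    -- Above a point a of parity k, the terms of parity k+1 come in pairs (a+1 counted, a+2 not).
    Φsum-as-Ψ : ∀ k j d a → sameParity a k ≡ true → ∃ λ P → a ℕ.+ d ℕ.≤ end₂ a P × Φsum k j a (a ℕ.+ d) ≡ Ψ j a P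
    Φsum-as-Ψ k j zero a _ = 0 , ℕP.≤-reflexive (ℕP.+-identityʳ a) , (begin
      sumTo (a ℕ.+ 0) F - sumTo a F  ≡⟨ cong (λ z → sumTo z F - sumTo a F) (ℕP.+-identityʳ a) ⟩
      sumTo a F - sumTo a F          ≡⟨ ℚP.+-inverseʳ (sumTo a F) ⟩
      0ℚ                             ≡⟨ Ψ-zero j a ⟨
      Ψ j a 0                        ∎)
      where
      open ≡-Reasoning
      F = Φterm k j
    Φsum-as-Ψ k j (suc zero) a same = 1 , ℕP.≤-trans (ℕP.≤-reflexive a+1≡) (ℕP.n≤1+n (suc a)) , (begin
      sumTo (a ℕ.+ 1) F - sumTo a F                 ≡⟨ cong (λ z → sumTo z F - sumTo a F) a+1≡ ⟩
      sumTo a F + F (suc a) - sumTo a F             ≡⟨ cancel (sumTo a F) (F (suc a)) ⟩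
      F (suc a)                                     ≡⟨ Φterm-same k j (suc a) (trans (sameParity-suc a k) same) ⟩
      recip (suc a) * Φ j (suc a)                   ≡⟨ ℚP.+-identityʳ _ ⟨
      recip (suc a) * Φ j (suc a) + 0ℚ              ≡⟨ cong (recip (suc a) * Φ j (suc a) +_) (Ψ-zero j (suc (suc a))) ⟨
      recip (suc a) * Φ j (suc a) + Ψ j (suc (suc a)) 0 ≡⟨ Ψ-suc j a 0 ⟨
      Ψ j a 1                                       ∎)
      where
      open ≡-Reasoning
      F = Φterm k j
      a+1≡ : a ℕ.+ 1 ≡ suc a
      a+1≡ = ℕP.+-comm a 1
      cancel : ∀ s f → s + f - s ≡ f
      cancel = solve-ring ℚ-ring
    Φsum-as-Ψ k j (suc (suc d)) a same with Φsum-as-Ψ k j d (suc (suc a)) same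
    ... | P , a+2+d≤end , eq = suc P , subst (ℕ._≤ end₂ (suc (suc a)) P) (sym a+d+2≡) a+2+d≤end , (begin
      sumTo (a ℕ.+ suc (suc d)) F - sumTo a F
        ≡⟨ cong (λ z → sumTo z F - sumTo a F) a+d+2≡ ⟩
      sumTo (suc (suc a) ℕ.+ d) F - sumTo a F
        ≡⟨ regroup (sumTo (suc (suc a) ℕ.+ d) F) (sumTo a F) (F (suc a)) (F (suc (suc a))) ⟩
      (sumTo (suc (suc a) ℕ.+ d) F - sumTo (suc (suc a)) F) + (F (suc a) + F (suc (suc a)))
        ≡⟨ cong₂ (λ x y → x + (y + F (suc (suc a)))) eq (Φterm-same k j (suc a) (trans (sameParity-suc a k) same)) ⟩
      Ψ j (suc (suc a)) P + (recip (suc a) * Φ j (suc a) + F (suc (suc a)))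
        ≡⟨ cong (λ y → Ψ j (suc (suc a)) P + (recip (suc a) * Φ j (suc a) + y)) (Φterm-other k j (suc (suc a)) other) ⟩
      Ψ j (suc (suc a)) P + (recip (suc a) * Φ j (suc a) + 0ℚ)
        ≡⟨ cong (Ψ j (suc (suc a)) P +_) (ℚP.+-identityʳ _) ⟩
      Ψ j (suc (suc a)) P + recip (suc a) * Φ j (suc a)
        ≡⟨ trans (ℚP.+-comm (Ψ j (suc (suc a)) P) _) (sym (Ψ-suc j a P)) ⟩
      Ψ j a (suc P) ∎)
      where
      open ≡-Reasoning
      F = Φterm k j
      a+d+2≡ : a ℕ.+ suc (suc d) ≡ suc (suc a) ℕ.+ d
      a+d+2≡ = trans (ℕP.+-suc a (suc d)) (cong suc (ℕP.+-suc a d))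
      other : sameParity (suc (suc a)) (suc k) ≡ false
      other = trans (sameParity-suc (suc a) k) (sameParity-suc-false a k same)
      regroup : ∀ S s f₁ f₂ → S - s ≡ (S - (s + f₁ + f₂)) + (f₁ + f₂)
      regroup = solve-ring ℚ-ring

    Φsum-bounds : ∀ k j a m → sameParity a k ≡ true → a ℕ.≤ suc m →
      Φ (suc j) a - recip (suc m) ≤ Φsum k j a (suc m) × Φsum k j a (suc m) ≤ Φ (suc j) a + recip (suc K)
    Φsum-bounds k j a m same a≤M with Φsum-as-Ψ k j (suc m ℕ.∸ a) a same
    ... | P , M≤end , eq = lower , upper
      where
      open ℚP.≤-Reasoning
      a+d≡M : a ℕ.+ (suc m ℕ.∸ a) ≡ suc m
      a+d≡M = ℕP.m+[n∸m]≡n a≤M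
      R = Φsum k j a (suc m)
      R≡ : R ≡ Φ (suc j) a - Φ (suc j) (end₂ a P) + β₂ a P (suc K) * weight (suc j) K
      R≡ = trans (cong (λ z → sumTo z (Φterm k j) - sumTo a (Φterm k j)) (sym a+d≡M)) (trans eq (Ψ-abel j a P))
      0≤rest : 0ℚ ≤ β₂ a P (suc K) * weight (suc j) K
      0≤rest = 0≤-* (0≤β₂ a P (suc K)) (0≤weight (suc j) K)
      rest≤ : β₂ a P (suc K) * weight (suc j) K ≤ recip (suc K)
      rest≤ = begin
        β₂ a P (suc K) * weight (suc j) K  ≤⟨ *-monoˡ-≤-0≤ (0≤β₂ a P (suc K)) (weight≤1 (suc j) K) ⟩
        β₂ a P (suc K) * 1ℚ                ≡⟨ ℚP.*-identityʳ _ ⟩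
        β₂ a P (suc K)                     ≤⟨ β₂≤β a P K ⟩
        β a (suc K)                        ≤⟨ β≤recip a K ⟩
        recip (suc K)                      ∎
      lower : Φ (suc j) a - recip (suc m) ≤ R
      lower = begin
        Φ (suc j) a - recip (suc m)
          ≤⟨ -‿monoʳ-≤ {Φ (suc j) a} (Φ≤recip (suc j) m (end₂ a P) (subst (ℕ._≤ end₂ a P) a+d≡M M≤end)) ⟩
        Φ (suc j) a - Φ (suc j) (end₂ a P)
          ≤⟨ p≤p+q 0≤rest ⟩
        Φ (suc j) a - Φ (suc j) (end₂ a P) + β₂ a P (suc K) * weight (suc j) K
          ≡⟨ R≡ ⟨
        R ∎
      upper : R ≤ Φ (suc j) a + recip (suc K)
      upper = begin
        R                                                                         ≡⟨ R≡ ⟩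
        Φ (suc j) a - Φ (suc j) (end₂ a P) + β₂ a P (suc K) * weight (suc j) K    ≤⟨ ℚP.+-mono-≤ (p-q≤p {Φ (suc j) a} (0≤Φ (suc j) (end₂ a P))) rest≤ ⟩
        Φ (suc j) a + recip (suc K)                                               ∎

    -- The lowest k+1 levels summed exactly up to M, the j levels above them replaced by Φ j.
    mixed : ℕ → ℕ → ℕ → ℚ
    mixed k j M = sumTo M (λ n → tailTerm k n * Φ j n)

    value : ℕ → ℚ
    value j = Φ j 0

    mixed-suc : ∀ k j M → mixed (suc k) j M ≡ sumTo M (λ a → tailTerm k a * Φsum (suc k) j a M)
    mixed-suc k j M = trans (sumTo-cong M (λ n _ → reorder (sameParity (suc n) (suc (suc k))) n))
      (sumTo-exchange-< M (Φterm (suc k) j) (tailTerm k))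
      where
      reorder : ∀ b n → (if b then inv-pow (suc n) 1 * sumTo n (tailTerm k) else 0ℚ) * Φ j (suc n)
                      ≡ (if b then recip (suc n) * Φ j (suc n) else 0ℚ) * sumTo n (tailTerm k)
      reorder true n = trans (cong (λ t → t * sumTo n (tailTerm k) * Φ j (suc n)) (inv-pow-1 n)) (swap (recip (suc n)) (sumTo n (tailTerm k)) (Φ j (suc n)))
        where
        swap : ∀ w y z → w * y * z ≡ w * z * y
        swap = solve-ring ℚ-ring
      reorder false n = trans (ℚP.*-zeroˡ (Φ j (suc n))) (sym (ℚP.*-zeroˡ (sumTo n (tailTerm k))))

    tailTerm-*-Φsum-bounds : ∀ k j m a → a ℕ.≤ suc m →
      tailTerm k a * (Φ (suc j) a - recip (suc m)) ≤ tailTerm k a * Φsum (suc k) j a (suc m) ×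
      tailTerm k a * Φsum (suc k) j a (suc m) ≤ tailTerm k a * (Φ (suc j) a + recip (suc K))
    tailTerm-*-Φsum-bounds k j m a a≤M with sameParity a (suc k) in same
    ... | true = *-mono-bounds _ (0≤-* (0≤inv-pow a 1) (0≤tail1 k a)) (Φsum-bounds (suc k) j a m same a≤M)
    ... | false = 0*≤0* (Φ (suc j) a - recip (suc m)) R , 0*≤0* R (Φ (suc j) a + recip (suc K))
      where
      R = Φsum (suc k) j a (suc m)
      0*≤0* : ∀ x y → 0ℚ * x ≤ 0ℚ * y
      0*≤0* x y = ℚP.≤-reflexive (trans (ℚP.*-zeroˡ x) (sym (ℚP.*-zeroˡ y)))

    mixed-suc-bounds : ∀ k j m →
      mixed k (suc j) (suc m) - recip (suc m) * tail1 (suc k) (suc (suc m)) ≤ mixed (suc k) j (suc m) ×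
      mixed (suc k) j (suc m) ≤ mixed k (suc j) (suc m) + recip (suc K) * tail1 (suc k) (suc (suc m))
    mixed-suc-bounds k j m = lower , upper
      where
      open ℚP.≤-Reasoning
      M = suc m
      s = tailTerm k
      bounds : ∀ a → suc a ℕ.≤ M → _
      bounds a a<M = tailTerm-*-Φsum-bounds k j m (suc a) a<M
      split : ∀ c → sumTo M (λ a → s a * (Φ (suc j) a + c)) ≡ mixed k (suc j) M + c * sumTo M s
      split c = trans (sumTo-cong M (λ a _ → ℚP.*-distribˡ-+ (s (suc a)) _ c))
        (trans (sumTo-+ M _ _) (cong (mixed k (suc j) M +_) (trans (sumTo-*ʳ M c s) (ℚP.*-comm (sumTo M s) c))))
      lower = begin
        mixed k (suc j) M - recip M * sumTo M s               ≡⟨ cong (mixed k (suc j) M +_) (ℚP.neg-distribˡ-* (recip M) (sumTo M s)) ⟩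
        mixed k (suc j) M + - recip M * sumTo M s             ≡⟨ split (- recip M) ⟨
        sumTo M (λ a → s a * (Φ (suc j) a - recip M))         ≤⟨ sumTo-mono-≤ M (λ a a<M → proj₁ (bounds a a<M)) ⟩
        sumTo M (λ a → s a * Φsum (suc k) j a M)              ≡⟨ mixed-suc k j M ⟨
        mixed (suc k) j M                                     ∎
      upper = begin
        mixed (suc k) j M                                     ≡⟨ mixed-suc k j M ⟩
        sumTo M (λ a → s a * Φsum (suc k) j a M)              ≤⟨ sumTo-mono-≤ M (λ a a<M → proj₂ (bounds a a<M)) ⟩
        sumTo M (λ a → s a * (Φ (suc j) a + recip (suc K)))   ≡⟨ split (recip (suc K)) ⟩
        mixed k (suc j) M + recip (suc K) * sumTo M s         ∎

    mixed-zero : ∀ j M → mixed 0 j M ≡ Φsum 0 j 0 M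
    mixed-zero j M = trans (sumTo-cong M (λ n _ → term (sameParity (suc n) 1) n)) (sym (ℚP.+-identityʳ _))
      where
      term : ∀ b n → (if b then inv-pow (suc n) 1 * 1ℚ else 0ℚ) * Φ j (suc n) ≡ (if b then recip (suc n) * Φ j (suc n) else 0ℚ)
      term true n = cong (_* Φ j (suc n)) (trans (ℚP.*-identityʳ _) (inv-pow-1 n))
      term false n = ℚP.*-zeroˡ (Φ j (suc n))

    mixed-bounds : ∀ k j m →
      value (suc (j ℕ.+ k)) - recip (suc m) * tailsUpTo k (suc m) ≤ mixed k j (suc m) ×
      mixed k j (suc m) ≤ value (suc (j ℕ.+ k)) + recip (suc K) * tailsUpTo k (suc m)
    mixed-bounds zero j m
      rewrite ℕP.+-identityʳ j | ℚP.*-identityʳ (recip (suc m)) | ℚP.*-identityʳ (recip (suc K)) | mixed-zero j (suc m)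
      = Φsum-bounds 0 j 0 m refl z≤n
    mixed-bounds (suc k) j m rewrite ℕP.+-suc j k =
      widen {value (suc (suc j ℕ.+ k))} {e = recip (suc m)} {recip (suc K)} {tailsUpTo k (suc m)} {tail1 (suc k) (suc (suc m))}
        (mixed-bounds k (suc j) m) (mixed-suc-bounds k j m)
      where
      widen : ∀ {v x y e e′ T t} → v - e * T ≤ x × x ≤ v + e′ * T → x - e * t ≤ y × y ≤ x + e′ * t →
              v - e * (T + t) ≤ y × y ≤ v + e′ * (T + t)
      widen {v} {x} {y} {e} {e′} {T} {t} (v-eT≤x , x≤v+e′T) (x-et≤y , y≤x+e′t) =
        ℚP.≤-trans (ℚP.≤-reflexive (lower-eq v e T t)) (ℚP.≤-trans (ℚP.+-monoˡ-≤ (- (e * t)) v-eT≤x) x-et≤y) ,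
        ℚP.≤-trans y≤x+e′t (ℚP.≤-trans (ℚP.+-monoˡ-≤ (e′ * t) x≤v+e′T) (ℚP.≤-reflexive (upper-eq v e′ T t)))
        where
        lower-eq : ∀ v e T t → v - e * (T + t) ≡ v - e * T - e * t
        lower-eq = solve-ring ℚ-ring
        upper-eq : ∀ v e T t → v + e * T + e * t ≡ v + e * (T + t)
        upper-eq = solve-ring ℚ-ring

    recip-as-Φ : ∀ m → recip (suc m) ≡ Φ 0 (suc m) + β m (suc K)
    recip-as-Φ m = sym (trans (cong (_+ β m (suc K)) (sumTo-cong K (λ c _ → ℚP.*-identityˡ (β (suc m) (suc c))))) (sumTo-β m K))

    muPartial-split : ∀ n M → muPartial (suc n) M ≡ mixed n 0 M + sumTo M (λ m → tailTerm n m * β (pred m) (suc K))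
    muPartial-split n M = trans (sumTo-cong M (λ m _ → term m (sameParity (suc m) (suc n)))) (sumTo-+ M _ _)
      where
      term : ∀ m b → (if b then inv-pow (suc m) 2 * tail1 n (suc m) else 0ℚ)
                   ≡ (if b then inv-pow (suc m) 1 * tail1 n (suc m) else 0ℚ) * Φ 0 (suc m)
                     + (if b then inv-pow (suc m) 1 * tail1 n (suc m) else 0ℚ) * β m (suc K)
      term m true = begin
        inv-pow (suc m) 2 * t                      ≡⟨ cong (_* t) (inv-pow-2 m) ⟩
        r * r * t                                  ≡⟨ swap r r t ⟩
        r * t * r                                  ≡⟨ cong (r * t *_) (recip-as-Φ m) ⟩
        r * t * (Φ 0 (suc m) + β m (suc K))        ≡⟨ ℚP.*-distribˡ-+ (r * t) _ _ ⟩
        r * t * Φ 0 (suc m) + r * t * β m (suc K)  ≡⟨ cong (λ x → x * t * Φ 0 (suc m) + x * t * β m (suc K)) (inv-pow-1 m) ⟨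
        inv-pow (suc m) 1 * t * Φ 0 (suc m) + inv-pow (suc m) 1 * t * β m (suc K) ∎
        where
        open ≡-Reasoning
        r = recip (suc m)
        t = tail1 n (suc m)
        swap : ∀ x y z → x * y * z ≡ x * z * y
        swap = solve-ring ℚ-ring
      term m false = sym (trans (cong₂ _+_ (ℚP.*-zeroˡ (Φ 0 (suc m))) (ℚP.*-zeroˡ (β m (suc K)))) (ℚP.+-identityʳ 0ℚ))

    muPartial-bounds : ∀ n m →
      value (suc n) - recip (suc m) * tailsUpTo n (suc m) ≤ muPartial (suc n) (suc m) ×
      muPartial (suc n) (suc m) ≤ value (suc n) + recip (suc K) * tailsUpTo (suc n) (suc m)
    muPartial-bounds n m = lower , upper
      where
      open ℚP.≤-Reasoning
      M = suc m
      rest = sumTo M (λ m → tailTerm n m * β (pred m) (suc K))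
      lower = begin
        value (suc n) - recip M * tailsUpTo n M  ≤⟨ proj₁ (mixed-bounds n 0 m) ⟩
        mixed n 0 M                              ≤⟨ p≤p+q (sumTo-nonneg M (λ a _ → 0≤-* (0≤tailTerm n (suc a)) (0≤β a (suc K)))) ⟩
        mixed n 0 M + rest                       ≡⟨ muPartial-split n M ⟨
        muPartial (suc n) M                      ∎
      rest≤ : rest ≤ recip (suc K) * tail1 (suc n) (suc M)
      rest≤ = begin
        rest                                     ≤⟨ sumTo-mono-≤ M (λ a _ → *-monoˡ-≤-0≤ (0≤tailTerm n (suc a)) (β≤recip a K)) ⟩
        sumTo M (λ a → tailTerm n a * recip (suc K)) ≡⟨ sumTo-*ʳ M (recip (suc K)) (tailTerm n) ⟩
        tail1 (suc n) (suc M) * recip (suc K)    ≡⟨ ℚP.*-comm _ (recip (suc K)) ⟩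
        recip (suc K) * tail1 (suc n) (suc M)    ∎
      upper = begin
        muPartial (suc n) M                      ≡⟨ muPartial-split n M ⟩
        mixed n 0 M + rest                       ≤⟨ ℚP.+-mono-≤ (proj₂ (mixed-bounds n 0 m)) rest≤ ⟩
        value (suc n) + recip (suc K) * tailsUpTo n M + recip (suc K) * tail1 (suc n) (suc M)
          ≡⟨ ℚP.+-assoc (value (suc n)) _ _ ⟩
        value (suc n) + (recip (suc K) * tailsUpTo n M + recip (suc K) * tail1 (suc n) (suc M))
          ≡⟨ cong (value (suc n) +_) (ℚP.*-distribˡ-+ (recip (suc K)) _ _) ⟨
        value (suc n) + recip (suc K) * tailsUpTo (suc n) M ∎

    value-formula : ∀ N → value N ≡ ½^ N * sumTo K (λ i → oddTerm (suc N) i * headsBy K i)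
    value-formula N = begin
      sumTo K (λ c → weight N c * β 0 c)
        ≡⟨ sumTo-cong K (λ c _ → term c) ⟩
      sumTo K (λ c → ½^ N * (½^ c * sumTo c (λ i → t i * toℚ (pred c C pred i))))
        ≡⟨ sumTo-*ˡ K (½^ N) _ ⟩
      ½^ N * sumTo K (λ c → ½^ c * sumTo c (λ i → t i * toℚ (pred c C pred i)))
        ≡⟨ cong (½^ N *_) inner ⟩
      ½^ N * sumTo K (λ i → t i * headsBy K i) ∎
      where
      open ≡-Reasoning
      t = oddTerm (suc N)
      term : ∀ c → weight N (suc c) * β 0 (suc c) ≡ ½^ N * (½^ suc c * sumTo (suc c) (λ i → t i * toℚ (c C pred i)))
      term c = begin
        weight N (suc c) * β 0 (suc c)                                 ≡⟨ cong₂ _*_ (weight-closed N c) (β-0 c) ⟩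
        ½^ N * ½^ suc c * oddRow N (suc c) * recip (suc c)             ≡⟨ regroup (½^ N) (½^ suc c) (oddRow N (suc c)) (recip (suc c)) ⟩
        ½^ N * (½^ suc c * (recip (suc c) * oddRow N (suc c)))         ≡⟨ cong (λ z → ½^ N * (½^ suc c * z)) (recip-oddRow N c) ⟩
        ½^ N * (½^ suc c * sumTo (suc c) (λ i → t i * toℚ (c C pred i))) ∎
        where
        regroup : ∀ h H C r → h * H * C * r ≡ h * (H * (r * C))
        regroup = solve-ring ℚ-ring
      inner : sumTo K (λ c → ½^ c * sumTo c (λ i → t i * toℚ (pred c C pred i))) ≡ sumTo K (λ i → t i * headsBy K i)
      inner = begin
        sumTo K (λ c → ½^ c * sumTo c (λ i → t i * toℚ (pred c C pred i)))
          ≡⟨ sumTo-cong K (λ c c<K → cong (½^ suc c *_) (sym (sumTo-C-extend t c K c<K))) ⟩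
        sumTo K (λ c → ½^ c * sumTo K (λ i → t i * toℚ (pred c C pred i)))
          ≡⟨ sumTo-cong K (λ c _ → sym (sumTo-*ˡ K (½^ suc c) (λ i → t i * toℚ (c C pred i)))) ⟩
        sumTo K (λ c → sumTo K (λ i → ½^ c * (t i * toℚ (pred c C pred i))))
          ≡⟨ sumTo-swap K K (λ c i → ½^ c * (t i * toℚ (pred c C pred i))) ⟩
        sumTo K (λ i → sumTo K (λ c → ½^ c * (t i * toℚ (pred c C pred i))))
          ≡⟨ sumTo-cong K (λ i _ → trans (sumTo-cong K (λ c _ → swap (½^ suc c) (t (suc i)) (toℚ (c C i))))
                                          (sumTo-*ˡ K (t (suc i)) (λ c → ½^ c * toℚ (pred c C i)))) ⟩
        sumTo K (λ i → t i * headsBy K i) ∎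
        where
        swap : ∀ H h b → H * (h * b) ≡ h * (H * b)
        swap = solve-ring ℚ-ring

    value≤valueLimit : ∀ N → value N ≤ valueLimit N K
    value≤valueLimit N = ℚP.≤-trans (ℚP.≤-reflexive (value-formula N))
      (*-monoˡ-≤-0≤ (0≤½^ N) (sumTo-mono-≤ K (λ i _ → subst (oddTerm (suc N) (suc i) * headsBy K (suc i) ≤_) (ℚP.*-identityʳ _)
        (*-monoˡ-≤-0≤ (0≤oddTerm (suc N) (suc i)) (headsBy≤1 K i)))))

    truncation-error : ℕ → ℚ
    truncation-error M₀ = toℚ M₀ * (toℚ 2 * (½^ K * binomPrefix M₀ K))

    valueLimit-≤-value : ∀ N M₀ → M₀ ℕ.≤ K → valueLimit N M₀ - truncation-error M₀ ≤ value N
    valueLimit-≤-value N M₀ M₀≤K = begin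
      valueLimit N M₀ - truncation-error M₀
        ≤⟨ -‿monoʳ-≤ {valueLimit N M₀} (subst (_≤ truncation-error M₀) (ℚP.*-comm (truncation-error M₀) (½^ N))
             (ℚP.≤-trans (*-monoˡ-≤-0≤ 0≤error (½^≤1 N)) (ℚP.≤-reflexive (ℚP.*-identityʳ _)))) ⟩
      ½^ N * sumTo M₀ t - ½^ N * truncation-error M₀
        ≡⟨ factor (½^ N) (sumTo M₀ t) (truncation-error M₀) ⟩
      ½^ N * (sumTo M₀ t - truncation-error M₀)
        ≤⟨ *-monoˡ-≤-0≤ (0≤½^ N) sums ⟩
      ½^ N * sumTo K (λ i → t i * headsBy K i)
        ≡⟨ value-formula N ⟨
      value N ∎
      where
      open ℚP.≤-Reasoning
      t = oddTerm (suc N)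
      c = toℚ 2 * (½^ K * binomPrefix M₀ K)
      0≤error : 0ℚ ≤ truncation-error M₀
      0≤error = 0≤-* (0≤toℚ M₀) (0≤-* (0≤toℚ 2) (0≤-* (0≤½^ K) (0≤binomPrefix M₀ K)))
      factor : ∀ h S d → h * S - h * d ≡ h * (S - d)
      factor = solve-ring ℚ-ring
      sums : sumTo M₀ t - truncation-error M₀ ≤ sumTo K (λ i → t i * headsBy K i)
      sums = begin
        sumTo M₀ t - toℚ M₀ * c                        ≡⟨ cong (λ x → sumTo M₀ t - x) (sumTo-const M₀ c) ⟨
        sumTo M₀ t - sumTo M₀ (λ _ → c)                ≡⟨ sumTo-minus M₀ t (λ _ → c) ⟨
        sumTo M₀ (λ i → t i - c)                       ≤⟨ sumTo-mono-≤ M₀ (oddTerm-*-headsBy≥ (suc N) K M₀) ⟩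
        sumTo M₀ (λ i → t i * headsBy K i)             ≤⟨ sumTo-monoˡ-≤ (λ i → 0≤-* (0≤oddTerm (suc N) (suc i)) (0≤headsBy K (suc i))) M₀≤K ⟩
        sumTo K (λ i → t i * headsBy K i)              ∎

  -- The odd part of ζ

  ζ-coefficient : ℕ → ℚ
  ζ-coefficient n = ((ℤ.+ (2 ^ suc (suc n)) ℤ.- ℤ.+ 1) / 2 ^ (2 ℕ.* suc n)) {{ℕP.m^n≢0 2 (2 ℕ.* suc n)}}

  ζ-coefficient-eq : ∀ n → ζ-coefficient n ≡ toℚ 2 * ½^ suc n - ½^ suc n * ½^ suc n
  ζ-coefficient-eq n = begin
    ζ-coefficient n
      ≡⟨ pred-÷ (2 ^ suc (suc n)) (2 ^ (2 ℕ.* suc n)) (ℕP.m^n>0 2 (suc (suc n))) ⟩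
    pred (2 ^ suc (suc n)) ÷ 2 ^ (2 ℕ.* suc n)
      ≡⟨ toℚ-*-1÷ (pred (2 ^ suc (suc n))) (2 ^ (2 ℕ.* suc n)) ⟨
    toℚ (pred (2 ^ suc (suc n))) * (1 ÷ 2 ^ (2 ℕ.* suc n))
      ≡⟨ cong₂ _*_ (trans (toℚ-pred (2 ^ suc (suc n)) (ℕP.m^n>0 2 (suc (suc n)))) (cong (_- 1ℚ) (toℚ-2^-suc (suc n))))
                   (trans (sym (½^≡1÷2^ (2 ℕ.* suc n))) (trans (cong ½^_ (cong (suc n ℕ.+_) (ℕP.+-identityʳ (suc n)))) (½^-+ (suc n) (suc n)))) ⟩
    (toℚ 2 * toℚ (2 ^ suc n) - 1ℚ) * (h * h)
      ≡⟨ regroup (toℚ 2) (toℚ (2 ^ suc n)) h ⟩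
    toℚ 2 * (h * toℚ (2 ^ suc n)) * h - h * h
      ≡⟨ cong (λ z → toℚ 2 * z * h - h * h) (½^*2^≡1 (suc n)) ⟩
    toℚ 2 * 1ℚ * h - h * h
      ≡⟨ cong (λ z → z * h - h * h) (ℚP.*-identityʳ (toℚ 2)) ⟩
    toℚ 2 * h - h * h ∎
    where
    open ≡-Reasoning
    h = ½^ suc n
    instance
      _ = ℕP.m^n≢0 2 (2 ℕ.* suc n)
    pred-÷ : ∀ a d .{{_ : ℕ.NonZero d}} → 1 ℕ.≤ a → ((ℤ.+ a ℤ.- ℤ.+ 1) / d) ≡ pred a ÷ d
    pred-÷ (suc a) d _ = refl
    toℚ-pred : ∀ a → 1 ℕ.≤ a → toℚ (pred a) ≡ toℚ a - 1ℚ
    toℚ-pred (suc a) _ = sym (trans (cong (_- 1ℚ) (toℚ-suc a)) (cancel (toℚ a)))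
      where
      cancel : ∀ x → 1ℚ + x - 1ℚ ≡ x
      cancel = solve-ring ℚ-ring
    regroup : ∀ t T h → (t * T - 1ℚ) * (h * h) ≡ t * (h * T) * h - h * h
    regroup = solve-ring ℚ-ring

  recip-double : ∀ k → recip (k ℕ.+ k) ≡ ½ * recip k
  recip-double zero = sym (ℚP.*-zeroʳ ½)
  recip-double (suc k) = sym (trans (÷-* 1 2 1 (suc k)) (÷-cong (1 ℕ.* 1) (2 ℕ.* suc k) 1 (suc k ℕ.+ suc k) (lemma k)))
    where
    lemma : ∀ k → 1 ℕ.* 1 ℕ.* (suc k ℕ.+ suc k) ≡ 1 ℕ.* (2 ℕ.* suc k)
    lemma = solve-∀

  inv-pow-double : ∀ k s → inv-pow (k ℕ.+ k) s ≡ ½^ s * inv-pow k s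
  inv-pow-double zero s = sym (ℚP.*-zeroʳ (½^ s))
  inv-pow-double (suc k) zero = refl
  inv-pow-double (suc k) (suc s) = begin
    inv-pow (suc k ℕ.+ suc k) (suc s)                       ≡⟨ inv-pow-suc (k ℕ.+ suc k) s ⟩
    recip (suc k ℕ.+ suc k) * inv-pow (suc k ℕ.+ suc k) s   ≡⟨ cong₂ _*_ (recip-double (suc k)) (inv-pow-double (suc k) s) ⟩
    ½ * recip (suc k) * (½^ s * inv-pow (suc k) s)          ≡⟨ regroup ½ (recip (suc k)) (½^ s) (inv-pow (suc k) s) ⟩
    ½ * ½^ s * (recip (suc k) * inv-pow (suc k) s)          ≡⟨ cong (½ * ½^ s *_) (inv-pow-suc k s) ⟨
    ½^ suc s * inv-pow (suc k) (suc s)                      ∎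
    where
    open ≡-Reasoning
    regroup : ∀ a b c d → a * b * (c * d) ≡ a * c * (b * d)
    regroup = solve-ring ℚ-ring

  sumTo-odd-even-double : ∀ f L → sumTo (L ℕ.+ L) f ≡ sumTo (L ℕ.+ L) (λ i → χodd i * f i) + sumTo L (λ k → f (k ℕ.+ k))
  sumTo-odd-even-double+1 : ∀ f L → sumTo (suc (L ℕ.+ L)) f ≡ sumTo (suc (L ℕ.+ L)) (λ i → χodd i * f i) + sumTo L (λ k → f (k ℕ.+ k))
  sumTo-odd-even-double f zero = sym (ℚP.+-identityˡ 0ℚ)
  sumTo-odd-even-double f (suc L) = begin
    sumTo (suc L ℕ.+ suc L) f
      ≡⟨ cong (λ z → sumTo z f) 2L+2≡ ⟩
    sumTo (suc (L ℕ.+ L)) f + f (suc (suc (L ℕ.+ L)))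
      ≡⟨ cong (_+ f (suc (suc (L ℕ.+ L)))) (sumTo-odd-even-double+1 f L) ⟩
    O + E + f (suc (suc (L ℕ.+ L)))
      ≡⟨ regroup O E (f (suc (suc (L ℕ.+ L)))) ⟩
    O + 0ℚ * f (suc (suc (L ℕ.+ L))) + (E + f (suc (suc (L ℕ.+ L))))
      ≡⟨ cong (λ x → O + x * f (suc (suc (L ℕ.+ L))) + (E + f (suc (suc (L ℕ.+ L))))) (trans (cong χodd (sym 2L+2≡)) (χodd-double (suc L))) ⟨
    O + χodd (suc (suc (L ℕ.+ L))) * f (suc (suc (L ℕ.+ L))) + (E + f (suc (suc (L ℕ.+ L))))
      ≡⟨ cong₂ (λ x y → sumTo x (λ i → χodd i * f i) + (E + f y)) 2L+2≡ 2L+2≡ ⟨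
    sumTo (suc L ℕ.+ suc L) (λ i → χodd i * f i) + sumTo (suc L) (λ k → f (k ℕ.+ k)) ∎
    where
    open ≡-Reasoning
    O = sumTo (suc (L ℕ.+ L)) (λ i → χodd i * f i)
    E = sumTo L (λ k → f (k ℕ.+ k))
    2L+2≡ : suc L ℕ.+ suc L ≡ suc (suc (L ℕ.+ L))
    2L+2≡ = cong suc (ℕP.+-suc L L)
    regroup : ∀ O E x → O + E + x ≡ O + 0ℚ * x + (E + x)
    regroup = solve-ring ℚ-ring
  sumTo-odd-even-double+1 f L = begin
    sumTo (L ℕ.+ L) f + f (suc (L ℕ.+ L))
      ≡⟨ cong (_+ f (suc (L ℕ.+ L))) (sumTo-odd-even-double f L) ⟩
    O + E + f (suc (L ℕ.+ L))
      ≡⟨ regroup O E (f (suc (L ℕ.+ L))) ⟩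
    O + 1ℚ * f (suc (L ℕ.+ L)) + E
      ≡⟨ cong (λ x → O + x * f (suc (L ℕ.+ L)) + E) (χodd-double+1 L) ⟨
    O + χodd (suc (L ℕ.+ L)) * f (suc (L ℕ.+ L)) + E ∎
    where
    open ≡-Reasoning
    O = sumTo (L ℕ.+ L) (λ i → χodd i * f i)
    E = sumTo L (λ k → f (k ℕ.+ k))
    regroup : ∀ O E x → O + E + x ≡ O + 1ℚ * x + E
    regroup = solve-ring ℚ-ring

  halve : ∀ M → ∃ λ L → M ≡ L ℕ.+ L ⊎ M ≡ suc (L ℕ.+ L)
  halve zero = 0 , inj₁ refl
  halve (suc M) with halve M
  ... | L , inj₁ M≡ = L , inj₂ (cong suc M≡)
  ... | L , inj₂ M≡ = suc L , inj₁ (cong suc (trans M≡ (sym (ℕP.+-suc L L))))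

  halve-≤ : ∀ {M L} → M ≡ L ℕ.+ L ⊎ M ≡ suc (L ℕ.+ L) → L ℕ.≤ M
  halve-≤ {L = L} (inj₁ refl) = ℕP.m≤m+n L L
  halve-≤ {L = L} (inj₂ refl) = ℕP.m≤n⇒m≤1+n (ℕP.m≤m+n L L)

  oddζ : ℕ → ℕ → ℚ
  oddζ s M = sumTo M (λ i → χodd i * inv-pow i s)

  zetaPartial-split : ∀ s M L → M ≡ L ℕ.+ L ⊎ M ≡ suc (L ℕ.+ L) → zetaPartial s M ≡ oddζ s M + ½^ s * zetaPartial s L
  zetaPartial-split s M L M≡ = trans (odd-even M≡) (cong (oddζ s M +_)
    (trans (sumTo-cong L (λ k _ → inv-pow-double (suc k) s)) (sumTo-*ˡ L (½^ s) (λ k → inv-pow k s))))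
    where
    odd-even : M ≡ L ℕ.+ L ⊎ M ≡ suc (L ℕ.+ L) → zetaPartial s M ≡ oddζ s M + sumTo L (λ k → inv-pow (k ℕ.+ k) s)
    odd-even (inj₁ refl) = sumTo-odd-even-double (λ n → inv-pow n s) L
    odd-even (inj₂ refl) = sumTo-odd-even-double+1 (λ n → inv-pow n s) L

  valueLimit≡ : ∀ N M → valueLimit N M ≡ ½^ N * (toℚ 2 * oddζ (suc N) M)
  valueLimit≡ N M = cong (½^ N *_) (trans (sumTo-cong M (λ i _ → swap (χodd (suc i)) (toℚ 2) (inv-pow (suc i) (suc N))))
    (sumTo-*ˡ M (toℚ 2) (λ i → χodd i * inv-pow i (suc N))))
    where
    swap : ∀ o t p → o * t * p ≡ t * (o * p)
    swap = solve-ring ℚ-ring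

  -- The even terms of ζ(n+2) are ζ(n+2)/2^(n+2), which turns the odd part into the coefficient times ζ.
  valueLimit-ζ-gap : ∀ n M L → M ≡ L ℕ.+ L ⊎ M ≡ suc (L ℕ.+ L) →
    valueLimit (suc n) M - ζ-coefficient n * zetaPartial (suc (suc n)) M ≡ ½^ suc n * ½^ suc n * (zetaPartial (suc (suc n)) M - zetaPartial (suc (suc n)) L)
  valueLimit-ζ-gap n M L M≡ = begin
    valueLimit (suc n) M - ζ-coefficient n * ζ M
      ≡⟨ cong₂ (λ x y → x - y * ζ M) (valueLimit≡ (suc n) M) (ζ-coefficient-eq n) ⟩
    h * (toℚ 2 * O) - (toℚ 2 * h - h * h) * ζ M
      ≡⟨ cong (λ z → h * (toℚ 2 * O) - (toℚ 2 * h - h * h) * z) (zetaPartial-split (suc (suc n)) M L M≡) ⟩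
    h * (toℚ 2 * O) - (toℚ 2 * h - h * h) * (O + ½ * h * Z)
      ≡⟨ regroup h O Z ½ (toℚ 2) ⟩
    h * h * (O + ½ * h * Z - Z) + h * h * Z * (1ℚ - ½ * toℚ 2)
      ≡⟨ cong (λ z → h * h * (O + ½ * h * Z - Z) + h * h * Z * (1ℚ - z)) ½*2≡1 ⟩
    h * h * (O + ½ * h * Z - Z) + h * h * Z * (1ℚ - 1ℚ)
      ≡⟨ drop h O Z ½ ⟩
    h * h * (O + ½ * h * Z - Z)
      ≡⟨ cong (λ z → h * h * (z - Z)) (zetaPartial-split (suc (suc n)) M L M≡) ⟨
    h * h * (ζ M - Z) ∎
    where
    open ≡-Reasoning
    ζ = zetaPartial (suc (suc n))
    h = ½^ suc n
    O = oddζ (suc (suc n)) M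
    Z = ζ L
    regroup : ∀ h O Z f t → h * (t * O) - (t * h - h * h) * (O + f * h * Z) ≡ h * h * (O + f * h * Z - Z) + h * h * Z * (1ℚ - f * t)
    regroup = solve-ring ℚ-ring
    drop : ∀ h O Z f → h * h * (O + f * h * Z - Z) + h * h * Z * (1ℚ - 1ℚ) ≡ h * h * (O + f * h * Z - Z)
    drop = solve-ring ℚ-ring

  ζ-coefficient-*-ζ≤valueLimit : ∀ n M → ζ-coefficient n * zetaPartial (suc (suc n)) M ≤ valueLimit (suc n) M
  ζ-coefficient-*-ζ≤valueLimit n M with halve M
  ... | L , M≡ = 0≤p-q⇒q≤p (subst (0ℚ ≤_) (sym (valueLimit-ζ-gap n M L M≡))
    (0≤-* (0≤-* (0≤½^ (suc n)) (0≤½^ (suc n)))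
          (p≤q⇒0≤q-p (sumTo-monoˡ-≤ (λ i → 0≤inv-pow (suc i) (suc (suc n))) {L} {M} (halve-≤ M≡)))))

  recip-step : ∀ m → recip (suc m) * recip (suc (suc m)) + recip (suc (suc m)) ≡ recip (suc m)
  recip-step m = begin
    recip (suc m) * recip (suc (suc m)) + recip (suc (suc m))
      ≡⟨ cong (_+ recip (suc (suc m))) (recip-* m (suc m)) ⟩
    1 ÷ (suc m ℕ.* suc (suc m)) + 1 ÷ suc (suc m)
      ≡⟨ ÷-+ 1 (suc m ℕ.* suc (suc m)) 1 (suc (suc m)) ⟩
    (1 ℕ.* suc (suc m) ℕ.+ 1 ℕ.* (suc m ℕ.* suc (suc m))) ÷ (suc m ℕ.* suc (suc m) ℕ.* suc (suc m))
      ≡⟨ ÷-cong (1 ℕ.* suc (suc m) ℕ.+ 1 ℕ.* (suc m ℕ.* suc (suc m))) (suc m ℕ.* suc (suc m) ℕ.* suc (suc m)) 1 (suc m) (cross m) ⟩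
    recip (suc m) ∎
    where
    open ≡-Reasoning
    cross : ∀ m → (1 ℕ.* suc (suc m) ℕ.+ 1 ℕ.* (suc m ℕ.* suc (suc m))) ℕ.* suc m ≡ 1 ℕ.* (suc m ℕ.* suc (suc m) ℕ.* suc (suc m))
    cross = solve-∀

  sumTo-recip²-tail : ∀ m d → sumTo d (λ i → recip (suc m ℕ.+ i) * recip (suc m ℕ.+ i)) + recip (suc m ℕ.+ d) ≤ recip (suc m)
  sumTo-recip²-tail m zero = ℚP.≤-reflexive (trans (ℚP.+-identityˡ _) (cong recip (ℕP.+-identityʳ (suc m))))
  sumTo-recip²-tail m (suc d) = begin
    S + r′ * r′ + r′                    ≡⟨ ℚP.+-assoc S (r′ * r′) r′ ⟩
    S + (r′ * r′ + r′)                  ≤⟨ ℚP.+-monoʳ-≤ S step ⟩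
    S + recip (suc m ℕ.+ d)             ≤⟨ sumTo-recip²-tail m d ⟩
    recip (suc m)                       ∎
    where
    open ℚP.≤-Reasoning
    S = sumTo d (λ i → recip (suc m ℕ.+ i) * recip (suc m ℕ.+ i))
    r′ = recip (suc m ℕ.+ suc d)
    m+d+2≡ : suc m ℕ.+ suc d ≡ suc (suc (m ℕ.+ d))
    m+d+2≡ = cong suc (ℕP.+-suc m d)
    step : r′ * r′ + r′ ≤ recip (suc m ℕ.+ d)
    step = subst (λ z → recip z * recip z + recip z ≤ recip (suc (m ℕ.+ d))) (sym m+d+2≡)
      (ℚP.≤-trans (ℚP.+-monoˡ-≤ (recip (suc (suc (m ℕ.+ d)))) (*-monoʳ-≤-0≤ (0≤recip (suc (suc (m ℕ.+ d)))) (recip-antimono (ℕP.n≤1+n (m ℕ.+ d)))))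
        (ℚP.≤-reflexive (recip-step (m ℕ.+ d))))

  inv-pow≤recip² : ∀ m s → inv-pow (suc m) (suc (suc s)) ≤ recip (suc m) * recip (suc m)
  inv-pow≤recip² m s = begin
    inv-pow (suc m) (suc (suc s))                       ≡⟨ trans (inv-pow-suc m (suc s)) (cong (recip (suc m) *_) (inv-pow-suc m s)) ⟩
    recip (suc m) * (recip (suc m) * inv-pow (suc m) s) ≤⟨ *-monoˡ-≤-0≤ (0≤recip (suc m)) (*-monoˡ-≤-0≤ (0≤recip (suc m)) (inv-pow≤1 (suc m) s)) ⟩
    recip (suc m) * (recip (suc m) * 1ℚ)                ≡⟨ cong (recip (suc m) *_) (ℚP.*-identityʳ (recip (suc m))) ⟩
    recip (suc m) * recip (suc m)                       ∎
    where open ℚP.≤-Reasoning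

  zetaPartial-tail : ∀ s m d → sumTo d (λ i → inv-pow (suc m ℕ.+ i) (suc (suc s))) ≤ recip (suc m)
  zetaPartial-tail s m d = ℚP.≤-trans (sumTo-mono-≤ d (λ i _ → inv-pow≤recip² (m ℕ.+ suc i) s))
    (ℚP.≤-trans (p≤p+q (0≤recip (suc m ℕ.+ d))) (sumTo-recip²-tail m d))

  double-<-cancel : ∀ {l L} → l ℕ.+ l ℕ.< L ℕ.+ L → l ℕ.< L
  double-<-cancel {l} {L} lt with l ℕ.<? L
  ... | yes l<L = l<L
  ... | no l≮L = contradiction lt (ℕP.≤⇒≯ (ℕP.+-mono-≤ L≤l L≤l))
    where
    L≤l = ℕP.≮⇒≥ l≮L

  valueLimit≤ : ∀ n l M → suc l ℕ.+ suc l ℕ.≤ M →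
    valueLimit (suc n) M ≤ ζ-coefficient n * zetaPartial (suc (suc n)) M + recip (suc l)
  valueLimit≤ n l M 2l+2≤M with halve M
  ... | L , M≡ = p-q≤r⇒p≤q+r (begin
    valueLimit (suc n) M - ζ-coefficient n * ζ M          ≡⟨ valueLimit-ζ-gap n M L M≡ ⟩
    h * h * (ζ M - ζ L)                                ≤⟨ *-monoʳ-≤-0≤ (p≤q⇒0≤q-p (sumTo-monoˡ-≤ (λ i → 0≤inv-pow (suc i) (suc (suc n))) {L} {M} (halve-≤ M≡)))
                                                            (*-≤1 (0≤½^ (suc n)) (½^≤1 (suc n)) (½^≤1 (suc n))) ⟩
    1ℚ * (ζ M - ζ L)                                   ≡⟨ ℚP.*-identityˡ _ ⟩
    ζ M - ζ L                                          ≡⟨ cong (λ x → x - ζ L) (trans (cong ζ (sym (ℕP.m+[n∸m]≡n (halve-≤ {M} {L} M≡)))) (sumTo-split L (M ℕ.∸ L) _)) ⟩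
    ζ L + sumTo (M ℕ.∸ L) (λ i → inv-pow (L ℕ.+ i) (suc (suc n))) - ζ L
                                                       ≡⟨ cancel (ζ L) _ ⟩
    sumTo (M ℕ.∸ L) (λ i → inv-pow (L ℕ.+ i) (suc (suc n)))
                                                       ≤⟨ tail L l<L ⟩
    recip (suc l)                                      ∎)
    where
    open ℚP.≤-Reasoning
    ζ = zetaPartial (suc (suc n))
    h = ½^ suc n
    cancel : ∀ a b → a + b - a ≡ b
    cancel = solve-ring ℚ-ring
    M≤2L+1 : M ℕ.≤ suc (L ℕ.+ L)
    M≤2L+1 = [ (λ M≡2L → ℕP.≤-trans (ℕP.≤-reflexive M≡2L) (ℕP.n≤1+n _)) , ℕP.≤-reflexive ]′ M≡
    l<L : l ℕ.< L
    l<L = double-<-cancel (ℕP.≤-pred (ℕP.≤-trans (ℕP.≤-reflexive (cong suc (sym (ℕP.+-suc l l)))) (ℕP.≤-trans 2l+2≤M M≤2L+1)))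
    tail : ∀ L → l ℕ.< L → sumTo (M ℕ.∸ L) (λ i → inv-pow (L ℕ.+ i) (suc (suc n))) ≤ recip (suc l)
    tail (suc L′) (s≤s l≤L′) = ℚP.≤-trans (zetaPartial-tail n L′ (M ℕ.∸ suc L′)) (recip-antimono l≤L′)

  ½^-suc-*-2 : ∀ n → ½^ suc n * toℚ 2 ≡ ½^ n
  ½^-suc-*-2 n = trans (swap ½ (½^ n) (toℚ 2)) (trans (cong (_* ½^ n) ½*2≡1) (ℚP.*-identityˡ (½^ n)))
    where
    swap : ∀ a b c → a * b * c ≡ a * c * b
    swap = solve-ring ℚ-ring

  valueLimit-tail : ∀ n m d → valueLimit (suc n) (suc m ℕ.+ d) ≤ valueLimit (suc n) (suc m) + recip (suc m)
  valueLimit-tail n m d = begin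
    ½^ N * sumTo (suc m ℕ.+ d) t
      ≡⟨ trans (cong (½^ N *_) (sumTo-split (suc m) d t)) (ℚP.*-distribˡ-+ (½^ N) _ _) ⟩
    valueLimit N (suc m) + ½^ N * sumTo d (λ i → t (suc m ℕ.+ i))
      ≡⟨ cong (valueLimit N (suc m) +_) (sumTo-*ˡ d (½^ N) (λ i → t (suc m ℕ.+ i))) ⟨
    valueLimit N (suc m) + sumTo d (λ i → ½^ N * t (suc m ℕ.+ i))
      ≤⟨ ℚP.+-monoʳ-≤ (valueLimit N (suc m)) (sumTo-mono-≤ d (λ i _ → term (suc m ℕ.+ suc i))) ⟩
    valueLimit N (suc m) + sumTo d (λ i → inv-pow (suc m ℕ.+ i) (suc N))
      ≤⟨ ℚP.+-monoʳ-≤ (valueLimit N (suc m)) (zetaPartial-tail n m d) ⟩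
    valueLimit N (suc m) + recip (suc m) ∎
    where
    open ℚP.≤-Reasoning
    N = suc n
    t = oddTerm (suc N)
    regroup : ∀ h o t p → h * (o * t * p) ≡ o * (h * t) * p
    regroup = solve-ring ℚ-ring
    term : ∀ i → ½^ N * t i ≤ inv-pow i (suc N)
    term i = begin
      ½^ N * (χodd i * toℚ 2 * inv-pow i (suc N))   ≡⟨ regroup (½^ N) (χodd i) (toℚ 2) (inv-pow i (suc N)) ⟩
      χodd i * (½^ N * toℚ 2) * inv-pow i (suc N)   ≤⟨ *-monoʳ-≤-0≤ (0≤inv-pow i (suc N)) coefficient≤1 ⟩
      1ℚ * inv-pow i (suc N)                        ≡⟨ ℚP.*-identityˡ _ ⟩
      inv-pow i (suc N)                             ∎
      where
      coefficient≤1 : χodd i * (½^ N * toℚ 2) ≤ 1ℚ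
      coefficient≤1 = *-≤1 (proj₁ (0≤χodd≤1 i)) (proj₂ (0≤χodd≤1 i))
        (subst (_≤ 1ℚ) (sym (½^-suc-*-2 n)) (½^≤1 n))

  -- Growth estimates and convergence

  n<2^n : ∀ n → n ℕ.< 2 ^ n
  n<2^n zero = s≤s z≤n
  n<2^n (suc n) = ℕP.≤-trans (ℕP.≤-reflexive (ℕP.+-comm 1 (suc n)))
    (ℕP.+-mono-≤ (n<2^n n) (ℕP.≤-trans (ℕP.m^n>0 2 n) (ℕP.≤-reflexive (sym (ℕP.+-identityʳ (2 ^ n))))))

  2u²+1≤2^2u : ∀ u → (u ℕ.+ u) ℕ.* u ℕ.+ 1 ℕ.≤ 2 ^ (u ℕ.+ u)
  2u²+1≤2^2u zero = ℕP.≤-refl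
  2u²+1≤2^2u (suc zero) = s≤s (s≤s (s≤s z≤n))
  2u²+1≤2^2u (suc (suc w)) = begin
    (u ℕ.+ u) ℕ.* u ℕ.+ 1                                    ≤⟨ ℕP.m≤m+n _ (6 ℕ.* w ℕ.* w ℕ.+ 8 ℕ.* w ℕ.+ 3) ⟩
    (u ℕ.+ u) ℕ.* u ℕ.+ 1 ℕ.+ (6 ℕ.* w ℕ.* w ℕ.+ 8 ℕ.* w ℕ.+ 3) ≡⟨ expand w ⟩
    4 ℕ.* ((suc w ℕ.+ suc w) ℕ.* suc w ℕ.+ 1)                ≤⟨ ℕP.*-monoʳ-≤ 4 (2u²+1≤2^2u (suc w)) ⟩
    4 ℕ.* 2 ^ (suc w ℕ.+ suc w)                              ≡⟨ quadruple (2 ^ (suc w ℕ.+ suc w)) ⟨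
    2 ^ suc (suc (suc w ℕ.+ suc w))                          ≡⟨ cong (λ z → 2 ^ suc z) (ℕP.+-suc (suc w) (suc w)) ⟨
    2 ^ (u ℕ.+ u)                                            ∎
    where
    open ℕP.≤-Reasoning
    u = suc (suc w)
    expand : ∀ w → (suc (suc w) ℕ.+ suc (suc w)) ℕ.* suc (suc w) ℕ.+ 1 ℕ.+ (6 ℕ.* w ℕ.* w ℕ.+ 8 ℕ.* w ℕ.+ 3)
                   ≡ 4 ℕ.* ((suc w ℕ.+ suc w) ℕ.* suc w ℕ.+ 1)
    expand = solve-∀
    quadruple : ∀ x → 2 ℕ.* (2 ℕ.* x) ≡ 4 ℕ.* x
    quadruple = solve-∀

  -- Take x + 1 = 2^(2u) with u > D + p + B: then D (x+1)^p < 2^(D + 2up) ≤ 2^(2u·u) ≤ 2^x.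
  2^-beats-polynomial : ∀ p D B → ∃ λ x → B ℕ.≤ x × D ℕ.* suc x ^ p ℕ.< 2 ^ x
  2^-beats-polynomial p D B = x , B≤x , bound
    where
    u = suc (D ℕ.+ p ℕ.+ B)
    Y = 2 ^ (u ℕ.+ u)
    instance
      _ = ℕP.m^n≢0 2 (u ℕ.+ u)
    x = pred Y
    x+1≡Y : suc x ≡ Y
    x+1≡Y = ℕP.suc-pred Y
    below-Y : ∀ {a} → a ℕ.+ 1 ℕ.≤ Y → a ℕ.≤ x
    below-Y {a} le = ℕP.≤-pred (ℕP.≤-trans (ℕP.≤-reflexive (ℕP.+-comm 1 a)) (ℕP.≤-trans le (ℕP.≤-reflexive (sym x+1≡Y))))
    D+p≤u : D ℕ.+ p ℕ.≤ u
    D+p≤u = ℕP.≤-trans (ℕP.m≤m+n (D ℕ.+ p) B) (ℕP.n≤1+n _)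
    E = (u ℕ.+ u) ℕ.* p
    D+E≤x : D ℕ.+ E ℕ.≤ x
    D+E≤x = below-Y (ℕP.≤-trans (ℕP.+-monoˡ-≤ 1 D+E≤2u²) (2u²+1≤2^2u u))
      where
      D+E≤2u² : D ℕ.+ E ℕ.≤ (u ℕ.+ u) ℕ.* u
      D+E≤2u² = ℕP.≤-trans (ℕP.+-monoˡ-≤ E (ℕP.m≤n*m D (u ℕ.+ u)))
        (ℕP.≤-trans (ℕP.≤-reflexive (sym (ℕP.*-distribˡ-+ (u ℕ.+ u) D p))) (ℕP.*-monoʳ-≤ (u ℕ.+ u) D+p≤u))
    B≤x : B ℕ.≤ x
    B≤x = below-Y (ℕP.≤-trans (ℕP.+-monoˡ-≤ 1 (ℕP.≤-trans (ℕP.≤-trans (ℕP.m≤n+m B (D ℕ.+ p)) (ℕP.n≤1+n _)) (ℕP.m≤n*m u (u ℕ.+ u))))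
                                 (2u²+1≤2^2u u))
    bound : D ℕ.* suc x ^ p ℕ.< 2 ^ x
    bound = begin-strict
      D ℕ.* suc x ^ p     ≡⟨ cong (λ z → D ℕ.* z ^ p) x+1≡Y ⟩
      D ℕ.* Y ^ p         ≡⟨ cong (D ℕ.*_) (ℕP.^-*-assoc 2 (u ℕ.+ u) p) ⟩
      D ℕ.* 2 ^ E         <⟨ ℕP.*-monoˡ-< (2 ^ E) {{ℕP.m^n≢0 2 E}} (n<2^n D) ⟩
      2 ^ D ℕ.* 2 ^ E     ≡⟨ ℕP.^-distribˡ-+-* 2 D E ⟨
      2 ^ (D ℕ.+ E)       ≤⟨ ℕP.^-monoʳ-≤ 2 D+E≤x ⟩
      2 ^ x               ∎
      where open ℕP.≤-Reasoning

  recip≤pos : ∀ ε → 0ℚ < ε → ∃ λ B → recip (suc B) ≤ ε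
  recip≤pos (mkℚ (ℤ.+ suc a) d c) _ = d , ℚP.≤-trans (÷-mono-≤ 1 (suc d) (suc a) (suc d) (ℕP.*-monoˡ-≤ (suc d) {1} {suc a} (s≤s z≤n)))
    (ℚP.≤-reflexive (ℚP.↥p/↧p≡p (mkℚ (ℤ.+ suc a) d c)))
  recip≤pos (mkℚ (ℤ.+ zero) d c) (ℚ.*<* 0<0) = ⊥-elim (ℤP.<-irrefl refl 0<0)
  recip≤pos (mkℚ ℤ.-[1+ a ] d c) (ℚ.*<* ())

  ≤toℚ : ∀ x → ∃ λ A → x ≤ toℚ A
  ≤toℚ x@(mkℚ (ℤ.+ a) d c) = a , ℚP.≤-trans (ℚP.≤-reflexive (sym (ℚP.↥p/↧p≡p x))) (÷-mono-≤ a (suc d) a 1 (ℕP.*-monoʳ-≤ a (s≤s z≤n)))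
  ≤toℚ (mkℚ ℤ.-[1+ a ] d c) = 0 , ℚ.*≤* ℤ.-≤+

  1÷-*-toℚ≤ : ∀ a b .{{_ : ℕ.NonZero b}} F → a ℕ.* suc F ℕ.≤ b → (1 ÷ b) * toℚ a ≤ recip (suc F)
  1÷-*-toℚ≤ a b@(suc _) F le = ℚP.≤-trans (ℚP.≤-reflexive (÷-* 1 b a 1))
    (÷-mono-≤ (1 ℕ.* a) (b ℕ.* 1) 1 (suc F) (ℕP.≤-trans (ℕP.≤-reflexive (unit₁ a F)) (ℕP.≤-trans le (ℕP.≤-reflexive (unit₂ b)))))
    where
    unit₁ : ∀ a F → 1 ℕ.* a ℕ.* suc F ≡ a ℕ.* suc F
    unit₁ = solve-∀
    unit₂ : ∀ b → b ≡ 1 ℕ.* (b ℕ.* 1)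
    unit₂ = solve-∀

  ∣p∣<q : ∀ p q → - q < p → p < q → ∣ p ∣ < q
  ∣p∣<q p q -q<p p<q with ℚP.∣p∣≡p∨∣p∣≡-p p
  ... | inj₁ ∣p∣≡p = subst (_< q) (sym ∣p∣≡p) p<q
  ... | inj₂ ∣p∣≡-p = subst (_< q) (sym ∣p∣≡-p) (subst (- p <_) (neg-involutive q) (ℚP.neg-antimono-< -q<p))
    where
    neg-involutive : ∀ q → - (- q) ≡ q
    neg-involutive = solve-ring ℚ-ring

  thrice-recip< : ∀ B → recip (suc (3 ℕ.* suc B)) + recip (suc (3 ℕ.* suc B)) + recip (suc (3 ℕ.* suc B)) < recip (suc B)
  thrice-recip< B = begin-strict
    1 ÷ F + 1 ÷ F + 1 ÷ F     ≡⟨ cong (_+ 1 ÷ F) (÷-+-common 1 1 F) ⟩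
    2 ÷ F + 1 ÷ F             ≡⟨ ÷-+-common 2 1 F ⟩
    3 ÷ F                     <⟨ ÷-mono-< 3 F 1 (suc B) (ℕP.≤-reflexive (unit B)) ⟩
    1 ÷ suc B                 ∎
    where
    open ℚP.≤-Reasoning
    F = suc (3 ℕ.* suc B)
    unit : ∀ B → suc (3 ℕ.* suc B) ≡ 1 ℕ.* suc (3 ℕ.* suc B)
    unit = solve-∀

  ∣p-q∣<ε : ∀ {p q e ε} → q - e ≤ p → p ≤ q + e → e < ε → ∣ p - q ∣ < ε
  ∣p-q∣<ε {p} {q} {e} {ε} q-e≤p p≤q+e e<ε = ∣p∣<q (p - q) ε
    (ℚP.<-≤-trans (ℚP.neg-antimono-< e<ε) (subst₂ _≤_ (lower q e) refl (ℚP.+-monoˡ-≤ (- q) q-e≤p)))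
    (ℚP.≤-<-trans (subst₂ _≤_ refl (upper q e) (ℚP.+-monoˡ-≤ (- q) p≤q+e)) e<ε)
    where
    lower : ∀ q e → q - e - q ≡ - e
    lower = solve-ring ℚ-ring
    upper : ∀ q e → q + e - q ≡ e
    upper = solve-ring ℚ-ring

  muPartial≤ : ∀ n F M → suc F ℕ.+ suc F ℕ.≤ M →
    muPartial (suc n) M ≤ ζ-coefficient n * zetaPartial (suc (suc n)) M + (recip (suc F) + recip (suc F) + recip (suc F))
  muPartial≤ n F (suc m) 2F+2≤M = begin
    muPartial (suc n) M                          ≤⟨ proj₂ (muPartial-bounds n m) ⟩
    value (suc n) + recip (suc K) * T            ≤⟨ ℚP.+-mono-≤ (value≤valueLimit (suc n)) error≤ ⟩
    valueLimit (suc n) K + p                        ≤⟨ ℚP.+-monoˡ-≤ p (valueLimit-tail n m (A ℕ.* suc F)) ⟩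
    valueLimit (suc n) M + recip M + p              ≤⟨ ℚP.+-monoˡ-≤ p (ℚP.+-mono-≤ (valueLimit≤ n F M 2F+2≤M) (recip-antimono F≤m)) ⟩
    cζ + p + p + p                               ≡⟨ regroup cζ p ⟩
    cζ + (p + p + p)                             ∎
    where
    open ℚP.≤-Reasoning
    M = suc m
    p = recip (suc F)
    cζ = ζ-coefficient n * zetaPartial (suc (suc n)) M
    T = tailsUpTo (suc n) M
    A = proj₁ (≤toℚ T)
    K = M ℕ.+ A ℕ.* suc F
    open Truncated K
    error≤ : recip (suc K) * T ≤ p
    error≤ = ℚP.≤-trans (*-monoˡ-≤-0≤ (0≤recip (suc K)) (proj₂ (≤toℚ T)))
      (1÷-*-toℚ≤ A (suc K) F (ℕP.≤-trans (ℕP.m≤n+m (A ℕ.* suc F) M) (ℕP.n≤1+n K)))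
    F≤m : F ℕ.≤ m
    F≤m = ℕP.≤-pred (ℕP.≤-trans (ℕP.m≤m+n (suc F) (suc F)) 2F+2≤M)
    regroup : ∀ c p → c + p + p + p ≡ c + (p + p + p)
    regroup = solve-ring ℚ-ring

  tails-error≤ : ∀ n F ℓ m₁ → suc m₁ ≡ 2 ^ ℓ → suc (suc n) ℕ.* suc F ℕ.* suc ℓ ^ n ℕ.< 2 ^ ℓ →
    recip (suc m₁) + recip (suc m₁) * tailsUpTo n (suc m₁) ≤ recip (suc F)
  tails-error≤ n F ℓ m₁ M₁≡ growth = begin
    r + r * T                                ≡⟨ factor r T ⟩
    r * (1ℚ + T)                             ≤⟨ *-monoˡ-≤-0≤ (0≤recip (suc m₁)) (ℚP.+-monoʳ-≤ 1ℚ T≤) ⟩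
    r * (toℚ 1 + toℚ (suc n ℕ.* X))          ≡⟨ cong (r *_) (toℚ-+ 1 (suc n ℕ.* X)) ⟨
    r * toℚ (1 ℕ.+ suc n ℕ.* X)              ≤⟨ *-monoˡ-≤-0≤ (0≤recip (suc m₁)) (toℚ-mono-≤ (ℕP.+-monoˡ-≤ (suc n ℕ.* X) (ℕP.m^n>0 (suc ℓ) n))) ⟩
    r * toℚ (X ℕ.+ suc n ℕ.* X)              ≤⟨ 1÷-*-toℚ≤ (X ℕ.+ suc n ℕ.* X) (suc m₁) F
                                                 (ℕP.≤-trans (ℕP.≤-reflexive (regroupℕ X n F)) (ℕP.≤-trans (ℕP.<⇒≤ growth) (ℕP.≤-reflexive (sym M₁≡)))) ⟩
    recip (suc F)                            ∎
    where
    open ℚP.≤-Reasoning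
    r = recip (suc m₁)
    T = tailsUpTo n (suc m₁)
    X = suc ℓ ^ n
    T≤ : T ≤ toℚ (suc n ℕ.* X)
    T≤ = tailsUpTo≤ n (suc m₁) ℓ (subst (λ z → sumTo z recip ≤ toℚ (suc ℓ)) (sym M₁≡) (harmonic-2^ ℓ))
    factor : ∀ r T → r + r * T ≡ r * (1ℚ + T)
    factor = solve-ring ℚ-ring
    regroupℕ : ∀ X n F → (X ℕ.+ suc n ℕ.* X) ℕ.* suc F ≡ suc (suc n) ℕ.* suc F ℕ.* X
    regroupℕ = solve-∀

  truncation-error≤ : ∀ M₁ F K″ → 2 ℕ.* M₁ ℕ.* M₁ ℕ.* suc F ℕ.* suc K″ ^ M₁ ℕ.< 2 ^ K″ →
    Truncated.truncation-error (suc K″) M₁ ≤ recip (suc F)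
  truncation-error≤ M₁ F K″ growth = begin
    toℚ M₁ * (toℚ 2 * (½^ suc K″ * binomPrefix M₁ (suc K″)))
      ≤⟨ *-monoˡ-≤-0≤ (0≤toℚ M₁) (*-monoˡ-≤-0≤ (0≤toℚ 2) (ℚP.≤-trans (*-monoʳ-≤-0≤ (0≤binomPrefix M₁ (suc K″)) (½^-suc-≤ K″))
                                                                   (*-monoˡ-≤-0≤ (0≤½^ K″) (binomPrefix≤ M₁ K″)))) ⟩
    toℚ M₁ * (toℚ 2 * (½^ K″ * toℚ (M₁ ℕ.* Y)))
      ≡⟨ regroup (toℚ M₁) (toℚ 2) (½^ K″) (toℚ (M₁ ℕ.* Y)) ⟩
    ½^ K″ * (toℚ 2 * (toℚ M₁ * toℚ (M₁ ℕ.* Y)))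
      ≡⟨ cong₂ _*_ (½^≡1÷2^ K″) (sym (trans (toℚ-* 2 (M₁ ℕ.* (M₁ ℕ.* Y))) (cong (toℚ 2 *_) (toℚ-* M₁ (M₁ ℕ.* Y))))) ⟩
    (1 ÷ 2 ^ K″) * toℚ (2 ℕ.* (M₁ ℕ.* (M₁ ℕ.* Y)))
      ≤⟨ 1÷-*-toℚ≤ (2 ℕ.* (M₁ ℕ.* (M₁ ℕ.* Y))) (2 ^ K″) F (ℕP.≤-trans (ℕP.≤-reflexive (regroupℕ M₁ Y F)) (ℕP.<⇒≤ growth)) ⟩
    recip (suc F) ∎
    where
    open ℚP.≤-Reasoning
    instance
      _ = ℕP.m^n≢0 2 K″
    Y = suc K″ ^ M₁
    regroup : ∀ m t h l → m * (t * (h * l)) ≡ h * (t * (m * l))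
    regroup = solve-ring ℚ-ring
    regroupℕ : ∀ M Y F → 2 ℕ.* (M ℕ.* (M ℕ.* Y)) ℕ.* suc F ≡ 2 ℕ.* M ℕ.* M ℕ.* suc F ℕ.* Y
    regroupℕ = solve-∀

  muPartial≥-beyond : ∀ n F ℓ m₁ K″ → suc m₁ ≡ 2 ^ ℓ →
    suc (suc n) ℕ.* suc F ℕ.* suc ℓ ^ n ℕ.< 2 ^ ℓ →
    suc m₁ ℕ.≤ K″ → 2 ℕ.* suc m₁ ℕ.* suc m₁ ℕ.* suc F ℕ.* suc K″ ^ suc m₁ ℕ.< 2 ^ K″ →
    ∀ M → suc m₁ ℕ.≤ M →
    ζ-coefficient n * zetaPartial (suc (suc n)) M - (recip (suc F) + recip (suc F)) ≤ muPartial (suc n) M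
  muPartial≥-beyond n F ℓ m₁ K″ M₁≡ ℓ-growth M₁≤K″ K″-growth M M₁≤M = begin
    ζ-coefficient n * zetaPartial (suc (suc n)) M - (p + p)
      ≤⟨ ℚP.+-monoˡ-≤ (- (p + p)) (ℚP.≤-trans (ζ-coefficient-*-ζ≤valueLimit n M) valueLimit≤valueLimit-M₁) ⟩
    valueLimit (suc n) M₁ + r - (p + p)
      ≤⟨ ℚP.+-monoˡ-≤ (- (p + p)) (ℚP.+-monoˡ-≤ r (p-q≤r⇒p≤q+r {valueLimit (suc n) M₁} {truncation-error M₁} {value (suc n)}
           (valueLimit-≤-value (suc n) M₁ (ℕP.≤-trans M₁≤K″ (ℕP.n≤1+n K″))))) ⟩
    truncation-error M₁ + value (suc n) + r - (p + p)
      ≤⟨ ℚP.+-monoˡ-≤ (- (p + p)) (ℚP.+-monoˡ-≤ r (ℚP.+-monoˡ-≤ (value (suc n)) (truncation-error≤ M₁ F K″ K″-growth))) ⟩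
    p + value (suc n) + r - (p + p)
      ≡⟨ regroup₁ (value (suc n)) p r ⟩
    value (suc n) + r - p
      ≤⟨ -‿monoʳ-≤ {value (suc n) + r} (tails-error≤ n F ℓ m₁ M₁≡ ℓ-growth) ⟩
    value (suc n) + r - (r + r * tailsUpTo n M₁)
      ≡⟨ regroup₂ (value (suc n)) r (tailsUpTo n M₁) ⟩
    value (suc n) - r * tailsUpTo n M₁
      ≤⟨ proj₁ (muPartial-bounds n m₁) ⟩
    muPartial (suc n) M₁
      ≤⟨ muPartial-mono n M₁≤M ⟩
    muPartial (suc n) M ∎
    where
    open ℚP.≤-Reasoning
    p = recip (suc F)
    M₁ = suc m₁
    r = recip M₁
    open Truncated (suc K″)
    valueLimit≤valueLimit-M₁ : valueLimit (suc n) M ≤ valueLimit (suc n) M₁ + r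
    valueLimit≤valueLimit-M₁ = subst (λ z → valueLimit (suc n) z ≤ valueLimit (suc n) M₁ + r) (ℕP.m+[n∸m]≡n M₁≤M) (valueLimit-tail n m₁ (M ℕ.∸ M₁))
    regroup₁ : ∀ v p r → p + v + r - (p + p) ≡ v + r - p
    regroup₁ = solve-ring ℚ-ring
    regroup₂ : ∀ v r t → v + r - (r + r * t) ≡ v - r * t
    regroup₂ = solve-ring ℚ-ring

  muPartial≥ : ∀ n F → ∃ λ M₁ → ∀ M → M₁ ℕ.≤ M →
    ζ-coefficient n * zetaPartial (suc (suc n)) M - (recip (suc F) + recip (suc F)) ≤ muPartial (suc n) M
  muPartial≥ n F = choose-ℓ (2^-beats-polynomial n (suc (suc n) ℕ.* suc F) 0)
    where
    choose-ℓ : (∃ λ ℓ → 0 ℕ.≤ ℓ × suc (suc n) ℕ.* suc F ℕ.* suc ℓ ^ n ℕ.< 2 ^ ℓ) → ∃ λ M₁ → ∀ M → M₁ ℕ.≤ M →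
      ζ-coefficient n * zetaPartial (suc (suc n)) M - (recip (suc F) + recip (suc F)) ≤ muPartial (suc n) M
    choose-ℓ (ℓ , _ , ℓ-growth) = M₁ , muPartial≥-beyond n F ℓ m₁ K″ M₁≡ ℓ-growth (proj₁ (proj₂ K″-choice)) (proj₂ (proj₂ K″-choice))
      where
      m₁ = pred (2 ^ ℓ)
      M₁ = suc m₁
      M₁≡ : M₁ ≡ 2 ^ ℓ
      M₁≡ = ℕP.suc-pred (2 ^ ℓ) {{ℕP.m^n≢0 2 ℓ}}
      K″-choice = 2^-beats-polynomial M₁ (2 ℕ.* M₁ ℕ.* M₁ ℕ.* suc F) M₁
      K″ = proj₁ K″-choice

  muPartial-converges : ∀ n ε → 0ℚ < ε → ∃ λ M₀ → ∀ M → M₀ ℕ.≤ M →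
    ∣ muPartial (suc n) M - ζ-coefficient n * zetaPartial (suc (suc n)) M ∣ < ε
  muPartial-converges n ε 0<ε = M₁ ℕ.+ (suc F ℕ.+ suc F) , λ M M₀≤M → ∣p-q∣<ε
    (ℚP.≤-trans (-‿monoʳ-≤ {ζ-coefficient n * zetaPartial (suc (suc n)) M} (p≤p+q {p + p} (0≤recip (suc F)))) (proj₂ lower M (ℕP.≤-trans (ℕP.m≤m+n M₁ _) M₀≤M)))
    (muPartial≤ n F M (ℕP.≤-trans (ℕP.m≤n+m _ M₁) M₀≤M))
    (ℚP.<-≤-trans (thrice-recip< B) (proj₂ (recip≤pos ε 0<ε)))
    where
    B = proj₁ (recip≤pos ε 0<ε)
    F = 3 ℕ.* suc B
    p = recip (suc F)
    lower = muPartial≥ n F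
    M₁ = proj₁ lower

open import Data.Nat as ℕ using (ℕ; suc; _^_; _≤_)
open import Data.Nat.Properties using (m^n≢0)
open import Data.Integer using (+_; _-_)
open import Data.Rational using (ℚ; _/_; _*_; _<_; 0ℚ; ∣_∣) renaming (_-_ to _-q_)
open import Data.Product using (∃)

theorem4p3 : (n : ℕ) → (ε : ℚ) → 0ℚ < ε → ∃ λ M₀ → (M : ℕ) → M₀ ≤ M →
    ∣ muPartial (suc n) M -q ((+ (2 ^ suc (suc n)) - + 1) / (2 ^ (2 ℕ.* suc n))) {{m^n≢0 2 (2 ℕ.* suc n)}} * zetaPartial (suc (suc n)) M ∣ < ε
theorem4p3 = Proof.muPartial-converges
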